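{- Let $m$ and $s\ge 3$ be positive integers. Let $a_1,\ldots,a_s$ be positive integers such that $(a_1,a_2,\ldots,a_{s-1})=1$. For each two-element subset $\{i,j\}\subseteq[s]$ let $p_{\{i,j\}}$ be a prime, these $\binom{s}{2}$ primes being pairwise distinct, such that $p_{\{i,j\}}\nmid (a_i,a_j)$ for all distinct $i,j\in[s-1]$ and $p_{\{i,s\}}\nmid a_i$ for each $i\in[s-1]$. Then every positive integer \[ n\ge a_{s-1}\prod_{\{i,j\}\subseteq [s]\setminus\{s-1\},\,i\neq j}p_{\{i,j\}}^m+a_s\prod_{\{i,j\}\subseteq [s-1],\,i\neq j}p_{\{i,j\}}^m+\Big(\prod_{\{i,j\}\subseteq [s],\,i\neq j}p_{\{i,j\}}^m\Big)\sum_{k=1}^{s-2}\Big(\frac{a_ka_{s-1}}{(a_k,a_{s-1})}\cdot\frac{2}{p_{\{k,s-1\}}^m}+\sum_{l\in[s-2],\,l>k}\frac{a_ka_l}{(a_k,a_l)}\cdot\frac{1}{p_{\{k,l\}}^m}\Big) \] belongs to $\mathcal{S}^m_{s,s-2}(a_1,\ldots,a_s)$, and hence to $\mathcal{S}^m_{s,t}(a_1,\ldots,a_s)$ for every $t\in[s-2]$.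
   Context: $[n]=\{1,\ldots,n\}$; $(b_1,\ldots,b_k)$ denotes the greatest common divisor. For integers $b_1,\ldots,b_k$ not all zero and $m\in\mathbb{N}$, $(b_1,\ldots,b_k)_m$ denotes the largest integer of the form $d^m$ with $d\in\mathbb{N}$ dividing all of $b_1,\ldots,b_k$. For $s\ge3$, $1\le t\le s-1$ and positive integers $a_1,\ldots,a_s$, $\mathcal{S}^m_{s,t}(a_1,\ldots,a_s)$ is the set of all integers $\sum_{i=1}^s a_i\mu_i$ where $\mu_1,\ldots,\mu_s$ are positive integers with $(\mu_1,\ldots,\mu_s)_m=1$ and $(\mu_{i_1},\ldots,\mu_{i_t})_m>1$ for every $1\le i_1<\cdots<i_t\le s$. -}

module Defs where

open import Data.Nat using (ℕ; zero; suc; _+_; _*_; _∸_; _^_; _≤_; _<_; _/_)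
open import Data.Nat.Properties using (_<?_; _≟_; _≤?_)
open import Data.Nat.Divisibility using (_∣_)
open import Data.Nat.GCD using (gcd)
open import Data.Fin using (Fin; toℕ; fromℕ; inject₁)
import Data.Fin as F
open import Data.Fin.Subset using (Subset; _∈_; ∣_∣)
open import Data.Bool using (Bool; true; not; if_then_else_; _∧_)
open import Data.Product using (Σ; _×_; ∃)
open import Relation.Binary.PropositionalEquality using (_≡_)
open import Relation.Nullary.Decidable using (⌊_⌋)

prodF : ∀ {n} → (Fin n → ℕ) → ℕ
prodF {zero}  f = 1
prodF {suc n} f = f F.zero * prodF (λ i → f (F.suc i))

sumF : ∀ {n} → (Fin n → ℕ) → ℕ
sumF {zero}  f = 0
sumF {suc n} f = f F.zero + sumF (λ i → f (F.suc i))

-- gcd of a finite family (gcd with 0 is the identity)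
gcdF : ∀ {n} → (Fin n → ℕ) → ℕ
gcdF {zero}  f = 0
gcdF {suc n} f = gcd (f F.zero) (gcdF (λ i → f (F.suc i)))

-- natural-number division, used only where the division is exact
-- (the divisor is never 0 in the uses below; convention: x ÷ 0 = 0)
_÷_ : ℕ → ℕ → ℕ
x ÷ zero  = 0
x ÷ suc d = x / suc d

-- Product of f i j over two-element subsets {i,j} (encoded as i < j)
-- of Fin n with both i and j satisfying the predicate `ok`.
pairProd : ∀ {n} → (Fin n → Bool) → (Fin n → Fin n → ℕ) → ℕ
pairProd ok f =
  prodF (λ i → prodF (λ j →
    if ⌊ toℕ i <? toℕ j ⌋ ∧ ok i ∧ ok j then f i j else 1))

PowGcdIsOne : ℕ → ∀ {n} → (Fin n → ℕ) → Set
PowGcdIsOne m b = ∀ d → (∀ i → d ^ m ∣ b i) → d ≡ 1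

PowGcdGtOne : ℕ → ∀ {n} → Subset n → (Fin n → ℕ) → Set
PowGcdGtOne m S b = ∃ λ d → (2 ≤ d) × (∀ i → i ∈ S → d ^ m ∣ b i)

InS : (m s t : ℕ) → (Fin s → ℕ) → ℕ → Set
InS m s t a n =
  Σ (Fin s → ℕ) λ μ →
    (∀ i → 1 ≤ μ i) ×
    PowGcdIsOne m μ ×
    (∀ (S : Subset s) → ∣ S ∣ ≡ t → PowGcdGtOne m S μ) ×
    (n ≡ sumF (λ i → a i * μ i))

-- Throughout, s = 2 + q with q ≥ 1, indices are Fin (2 + q) (0-based):
-- paper index s-1 is 0-based q, paper index s is 0-based q+1.
pen : (q : ℕ) → Fin (2 + q)
pen q = inject₁ (fromℕ q)

lst : (q : ℕ) → Fin (2 + q)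
lst q = fromℕ (suc q)

-- keep b_i for indices i with toℕ i ≤ q (i.e. i ∈ [s-1]), replace by 0 otherwise
-- (0 is neutral for gcd), so gcdF of it is (a_1,…,a_{s-1}).
restrictTo : ℕ → ℕ → ℕ → ℕ
restrictTo k q x = if ⌊ k ≤? q ⌋ then x else 0

-- the lower bound in the theorem; the factor (∏_{all pairs} p^m) is
-- distributed into the sum over k so that all divisions are exact.
bound : (m q : ℕ) → (a : Fin (2 + q) → ℕ) → (p : Fin (2 + q) → Fin (2 + q) → ℕ) → ℕ
bound m q a p =
    a (pen q) * pairProd (λ i → not ⌊ toℕ i ≟ q ⌋) pp
  + a (lst q) * pairProd (λ i → ⌊ toℕ i <? suc q ⌋) pp
  + sumF (λ k → if ⌊ toℕ k <? q ⌋ then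
        ((a k * a (pen q)) ÷ gcd (a k) (a (pen q))) * ((2 * P) ÷ (p k (pen q) ^ m))
      + sumF (λ l → if ⌊ toℕ k <? toℕ l ⌋ ∧ ⌊ toℕ l <? q ⌋ then
          ((a k * a l) ÷ gcd (a k) (a l)) * (P ÷ (p k l ^ m))
        else 0)
      else 0)
  where
  pp : Fin (2 + q) → Fin (2 + q) → ℕ
  pp i j = p i j ^ m
  P : ℕ
  P = pairProd (λ _ → true) pp

{-# OPTIONS --safe #-}
-- Write μ k = M k * x k, where M k is the product of the p_{ij}^m over the pairs {i, j} avoiding k.
-- Any s - 2 indices miss some pair {u, w}, and p_{uw}^m divides all their M k, so it suffices to find
-- x ≥ 1 with x s = 1, Σ a k M k x k = n, and p_{ij}^m dividing at most one of x i, x j for i < j < s.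
-- Since a_{s-1} M_{s-1} is coprime to the a k M k with k ≤ s - 2, a linear congruence fixes x k for
-- k ≤ s - 2 in a bounded range and x_{s-1} takes up the rest. Each x j is then padded by the
-- lcm(a i, a j) ∏ p^m / p_{ij}^m for i < j (in units of a j M j), and whenever p_{ij}^m divides both
-- x i and x j that amount is moved from j to i; as p_{ij} cannot divide both a i / (a i, a j) and
-- a j / (a i, a j), the move destroys the common factor. The bound on n leaves room for all this.
module Submission where

open import Data.Bool using (Bool; true; false; if_then_else_; _∧_; _∨_; not)
import Data.Bool.Properties as Bool
open import Data.Empty using (⊥; ⊥-elim)
open import Data.Fin as Fin using (Fin; toℕ; fromℕ)
import Data.Fin.Properties as Fin
open import Data.Fin.Subset using (Subset; _∉_; ∣_∣)
open import Data.List using ([]; _∷_)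
open import Data.List.Relation.Unary.All using (_∷_)
open import Data.Nat
open import Data.Nat.DivMod
open import Data.Nat.Divisibility
open import Data.Nat.GCD
open import Data.Nat.ListAction using (product)
open import Data.Nat.Primality
open import Data.Nat.Primality.Factorisation using (factorise)
open import Data.Nat.Properties
open import Data.Nat.Tactic.RingSolver using (solve-∀)
open import Data.Product using (∃; _×_; _,_; proj₁; proj₂)
open import Data.Sum using (_⊎_; inj₁; inj₂; [_,_]′)
open import Data.Vec.Base using (_∷_; here; there)
open import Relation.Binary.Definitions using (tri<; tri≈; tri>)
open import Relation.Binary.PropositionalEquality
open import Relation.Nullary using (¬_; Dec; yes; no)
open import Relation.Nullary.Decidable using (⌊_⌋; decidable-stable)

open import Defs

-- Sums and products over Fin n

prodF-cong : ∀ {n} {f g : Fin n → ℕ} → (∀ i → f i ≡ g i) → prodF f ≡ prodF g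
prodF-cong {zero}  _ = refl
prodF-cong {suc n} h = cong₂ _*_ (h Fin.zero) (prodF-cong (λ i → h (Fin.suc i)))

sumF-cong : ∀ {n} {f g : Fin n → ℕ} → (∀ i → f i ≡ g i) → sumF f ≡ sumF g
sumF-cong {zero}  _ = refl
sumF-cong {suc n} h = cong₂ _+_ (h Fin.zero) (sumF-cong (λ i → h (Fin.suc i)))

prodF-* : ∀ {n} (f g : Fin n → ℕ) → prodF (λ i → f i * g i) ≡ prodF f * prodF g
prodF-* {zero}  _ _ = refl
prodF-* {suc n} f g =
  trans (cong (f Fin.zero * g Fin.zero *_) (prodF-* (λ i → f (Fin.suc i)) (λ i → g (Fin.suc i))))
        ([m*n]*[o*p]≡[m*o]*[n*p] (f Fin.zero) (g Fin.zero) _ _)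

sumF-+ : ∀ {n} (f g : Fin n → ℕ) → sumF (λ i → f i + g i) ≡ sumF f + sumF g
sumF-+ {zero}  _ _ = refl
sumF-+ {suc n} f g =
  trans (cong (f Fin.zero + g Fin.zero +_) (sumF-+ (λ i → f (Fin.suc i)) (λ i → g (Fin.suc i))))
        ([m+n]+[o+p]≡[m+o]+[n+p] (f Fin.zero) (g Fin.zero) _ _)
  where
  [m+n]+[o+p]≡[m+o]+[n+p] : ∀ a b c d → a + b + (c + d) ≡ a + c + (b + d)
  [m+n]+[o+p]≡[m+o]+[n+p] = solve-∀

sumF-*ˡ : ∀ {n} k (f : Fin n → ℕ) → sumF (λ i → k * f i) ≡ k * sumF f
sumF-*ˡ {zero}  k _ = sym (*-zeroʳ k)
sumF-*ˡ {suc n} k f =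
  trans (cong (k * f Fin.zero +_) (sumF-*ˡ k (λ i → f (Fin.suc i))))
        (sym (*-distribˡ-+ k (f Fin.zero) _))

sumF-zero : ∀ n → sumF {n} (λ _ → 0) ≡ 0
sumF-zero zero    = refl
sumF-zero (suc n) = sumF-zero n

prodF-one : ∀ n → prodF {n} (λ _ → 1) ≡ 1
prodF-one zero    = refl
prodF-one (suc n) = trans (+-identityʳ _) (prodF-one n)

sumF-comm : ∀ {n m} (f : Fin n → Fin m → ℕ) →
  sumF (λ i → sumF (λ j → f i j)) ≡ sumF (λ j → sumF (λ i → f i j))
sumF-comm {zero}  {m} _ = sym (sumF-zero m)
sumF-comm {suc n} f =
  trans (cong (sumF (f Fin.zero) +_) (sumF-comm (λ i → f (Fin.suc i))))
        (sym (sumF-+ (f Fin.zero) (λ j → sumF (λ i → f (Fin.suc i) j))))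

sumF-mono-≤ : ∀ {n} {f g : Fin n → ℕ} → (∀ i → f i ≤ g i) → sumF f ≤ sumF g
sumF-mono-≤ {zero}  _ = z≤n
sumF-mono-≤ {suc n} h = +-mono-≤ (h Fin.zero) (sumF-mono-≤ (λ i → h (Fin.suc i)))

sumF-single : ∀ {n} (f : Fin n → ℕ) j → (∀ i → i ≢ j → f i ≡ 0) → sumF f ≡ f j
sumF-single {suc n} f Fin.zero h =
  trans (cong (f Fin.zero +_) (trans (sumF-cong (λ i → h (Fin.suc i) (λ ()))) (sumF-zero n)))
        (+-identityʳ _)
sumF-single {suc n} f (Fin.suc j) h =
  trans (cong (_+ sumF (λ i → f (Fin.suc i))) (h Fin.zero (λ ())))
        (sumF-single (λ i → f (Fin.suc i)) j (λ i i≢j → h (Fin.suc i) (λ e → i≢j (Fin.suc-injective e))))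

prodF-single : ∀ {n} (f : Fin n → ℕ) j → (∀ i → i ≢ j → f i ≡ 1) → prodF f ≡ f j
prodF-single {suc n} f Fin.zero h =
  trans (cong (f Fin.zero *_) (trans (prodF-cong (λ i → h (Fin.suc i) (λ ()))) (prodF-one n)))
        (*-identityʳ _)
prodF-single {suc n} f (Fin.suc j) h =
  trans (cong (_* prodF (λ i → f (Fin.suc i))) (h Fin.zero (λ ())))
        (trans (+-identityʳ _)
               (prodF-single (λ i → f (Fin.suc i)) j (λ i i≢j → h (Fin.suc i) (λ e → i≢j (Fin.suc-injective e)))))

∣sumF : ∀ {n d} {f : Fin n → ℕ} → (∀ i → d ∣ f i) → d ∣ sumF f
∣sumF {zero}  _ = _ ∣0
∣sumF {suc n} h = ∣m∣n⇒∣m+n (h Fin.zero) (∣sumF (λ i → h (Fin.suc i)))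

sumF≡term+multiple : ∀ {n d} (f : Fin n → ℕ) j → (∀ i → i ≢ j → d ∣ f i) →
  ∃ λ r → d ∣ r × sumF f ≡ f j + r
sumF≡term+multiple {suc n} f Fin.zero h =
  sumF (λ i → f (Fin.suc i)) , ∣sumF (λ i → h (Fin.suc i) (λ ())) , refl
sumF≡term+multiple {suc n} f (Fin.suc j) h
  with sumF≡term+multiple (λ i → f (Fin.suc i)) j
         (λ i i≢j → h (Fin.suc i) (λ e → i≢j (Fin.suc-injective e)))
... | r , d∣r , eq =
  f Fin.zero + r , ∣m∣n⇒∣m+n (h Fin.zero (λ ())) d∣r ,
  trans (cong (f Fin.zero +_) eq) (x+[y+z]≡y+[x+z] (f Fin.zero) (f (Fin.suc j)) r)
  where
  x+[y+z]≡y+[x+z] : ∀ x y z → x + (y + z) ≡ y + (x + z)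
  x+[y+z]≡y+[x+z] = solve-∀

f∣prodF : ∀ {n} (f : Fin n → ℕ) i → f i ∣ prodF f
f∣prodF f Fin.zero    = m∣m*n _
f∣prodF f (Fin.suc i) = ∣n⇒∣m*n (f Fin.zero) (f∣prodF (λ j → f (Fin.suc j)) i)

1≤prodF : ∀ {n} {f : Fin n → ℕ} → (∀ i → 1 ≤ f i) → 1 ≤ prodF f
1≤prodF {zero}  _ = s≤s z≤n
1≤prodF {suc n} h = *-mono-≤ (h Fin.zero) (1≤prodF (λ i → h (Fin.suc i)))

sumF-%-cong : ∀ {n} c .{{_ : NonZero c}} (f g : Fin n → ℕ) →
  (∀ i → f i % c ≡ g i % c) → sumF f % c ≡ sumF g % c
sumF-%-cong {zero}  c f g h = refl
sumF-%-cong {suc n} c f g h =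
  trans (%-distribˡ-+ (f Fin.zero) _ c)
        (trans (cong₂ (λ u w → (u + w) % c) (h Fin.zero)
                      (sumF-%-cong c _ _ (λ i → h (Fin.suc i))))
               (sym (%-distribˡ-+ (g Fin.zero) _ c)))

-- Primes and powers

prime⇒2≤ : ∀ {r} → Prime r → 2 ≤ r
prime⇒2≤ pr = nonTrivial⇒n>1 _ {{prime⇒nonTrivial pr}}

prime∤1 : ∀ {r} → Prime r → ¬ (r ∣ 1)
prime∤1 pr r∣1 = <⇒≢ (prime⇒2≤ pr) (sym (∣1⇒≡1 r∣1))

prime∣prodF : ∀ {n r} (f : Fin n → ℕ) → Prime r → r ∣ prodF f → ∃ λ i → r ∣ f i
prime∣prodF {zero}  f pr r∣1 = ⊥-elim (prime∤1 pr r∣1)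
prime∣prodF {suc n} f pr r∣f with euclidsLemma (f Fin.zero) (prodF (λ i → f (Fin.suc i))) pr r∣f
... | inj₁ r∣f₀ = Fin.zero , r∣f₀
... | inj₂ r∣rest with prime∣prodF (λ i → f (Fin.suc i)) pr r∣rest
...   | i , r∣fᵢ = Fin.suc i , r∣fᵢ

prime∣prime⇒≡ : ∀ {r p} → Prime r → Prime p → r ∣ p → r ≡ p
prime∣prime⇒≡ pr pp r∣p with prime⇒irreducible pp r∣p
... | inj₁ refl = ⊥-elim (prime∤1 pr ∣-refl)
... | inj₂ r≡p  = r≡p

prime∣^⇒≡ : ∀ {r p} m → Prime r → Prime p → r ∣ p ^ m → r ≡ p
prime∣^⇒≡ zero    pr pp r∣1 = ⊥-elim (prime∤1 pr r∣1)
prime∣^⇒≡ {p = p} (suc m) pr pp r∣p^m+1 with euclidsLemma p (p ^ m) pr r∣p^m+1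
... | inj₁ r∣p   = prime∣prime⇒≡ pr pp r∣p
... | inj₂ r∣p^m = prime∣^⇒≡ m pr pp r∣p^m

prime^∣*⇒∣ : ∀ {r k x} m → Prime r → ¬ (r ∣ k) → r ^ m ∣ k * x → r ^ m ∣ x
prime^∣*⇒∣ {x = x} zero pr r∤k _ = 1∣ x
prime^∣*⇒∣ {r} {k} {x} (suc m) pr r∤k r^m+1∣kx
  with euclidsLemma k x pr (∣-trans (m∣m*n (r ^ m)) r^m+1∣kx)
... | inj₁ r∣k = ⊥-elim (r∤k r∣k)
... | inj₂ (divides x′ refl) =
  subst (_∣ x′ * r) (*-comm (r ^ m) r)
    (*-monoˡ-∣ r (prime^∣*⇒∣ m pr r∤k (*-cancelˡ-∣ r r*r^m∣r*kx′)))
  where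
  instance _ = prime⇒nonZero pr
  r*r^m∣r*kx′ : r * r ^ m ∣ r * (k * x′)
  r*r^m∣r*kx′ = subst (r * r ^ m ∣_) (x*[y*z]≡z*[x*y] k x′ r) r^m+1∣kx
    where
    x*[y*z]≡z*[x*y] : ∀ x y z → x * (y * z) ≡ z * (x * y)
    x*[y*z]≡z*[x*y] = solve-∀

∃prime∣ : ∀ d → 2 ≤ d → ∃ λ r → Prime r × r ∣ d
∃prime∣ d 2≤d with factorise d {{>-nonZero (≤-trans (s≤s z≤n) 2≤d)}}
... | record { factors = [] ; isFactorisation = d≡1 } = ⊥-elim (<⇒≢ 2≤d (sym d≡1))
... | record { factors = r ∷ rs ; isFactorisation = d≡r*rs ; factorsPrime = pr ∷ _ } =
  r , pr , divides (product rs) (trans d≡r*rs (*-comm r _))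

1≤^ : ∀ {p} m → 1 ≤ p → 1 ≤ p ^ m
1≤^ zero    _   = s≤s z≤n
1≤^ (suc m) 1≤p = *-mono-≤ 1≤p (1≤^ m 1≤p)

m∣m^n : ∀ {r} n → 1 ≤ n → r ∣ r ^ n
m∣m^n (suc n) _ = m∣m*n _

≢0⇒primeFree⇒≡1 : ∀ d → d ≢ 0 → (∀ {r} → Prime r → ¬ (r ∣ d)) → d ≡ 1
≢0⇒primeFree⇒≡1 zero          d≢0 _         = ⊥-elim (d≢0 refl)
≢0⇒primeFree⇒≡1 1             _   _         = refl
≢0⇒primeFree⇒≡1 d@(suc (suc _)) _ primeFree with ∃prime∣ d (s≤s (s≤s z≤n))
... | r , pr , r∣d = ⊥-elim (primeFree pr r∣d)

^-monoˡ-∣ : ∀ {a b} m → a ∣ b → a ^ m ∣ b ^ m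
^-monoˡ-∣ zero    _   = ∣-refl
^-monoˡ-∣ (suc m) a∣b = *-pres-∣ a∣b (^-monoˡ-∣ m a∣b)

-- Congruences and the gcd of a family

gcdF-∣ : ∀ {n} (f : Fin n → ℕ) i → gcdF f ∣ f i
gcdF-∣ f Fin.zero    = gcd[m,n]∣m (f Fin.zero) _
gcdF-∣ f (Fin.suc i) = ∣-trans (gcd[m,n]∣n (f Fin.zero) _) (gcdF-∣ (λ j → f (Fin.suc j)) i)

gcdF-greatest : ∀ {n d} (f : Fin n → ℕ) → (∀ i → d ∣ f i) → d ∣ gcdF f
gcdF-greatest {zero}  _ _ = _ ∣0
gcdF-greatest {suc n} f h =
  gcd-greatest (h Fin.zero) (gcdF-greatest (λ j → f (Fin.suc j)) (λ j → h (Fin.suc j)))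

÷≡/ : ∀ x d .{{_ : NonZero d}} → x ÷ d ≡ x / d
÷≡/ x (suc d) = refl

%-cong-+ˡ : ∀ k {a b} c .{{_ : NonZero c}} → a % c ≡ b % c → (k + a) % c ≡ (k + b) % c
%-cong-+ˡ k {a} {b} c a≡b = begin
  (k + a) % c           ≡⟨ %-distribˡ-+ k a c ⟩
  (k % c + a % c) % c   ≡⟨ cong (λ z → (k % c + z) % c) a≡b ⟩
  (k % c + b % c) % c   ≡⟨ %-distribˡ-+ k b c ⟨
  (k + b) % c           ∎
  where open ≡-Reasoning

%-cong-*ˡ : ∀ k {a b} c .{{_ : NonZero c}} → a % c ≡ b % c → (k * a) % c ≡ (k * b) % c
%-cong-*ˡ k {a} {b} c a≡b = begin
  (k * a) % c           ≡⟨ %-distribˡ-* k a c ⟩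
  (k % c * (a % c)) % c ≡⟨ cong (λ z → (k % c * z) % c) a≡b ⟩
  (k % c * (b % c)) % c ≡⟨ %-distribˡ-* k b c ⟨
  (k * b) % c           ∎
  where open ≡-Reasoning

-- Natural-number Bézout coefficients only exist up to sign, but modulo c the negative one can be
-- traded for a multiple of c - 1.
bézout-% : ∀ u g c .{{_ : NonZero c}} → ∃ λ X → ∃ λ Y → (u * X + g * Y) % c ≡ gcd u g % c
bézout-% u g c@(suc c′) with Bézout.identity (gcd-GCD u g)
... | Bézout.+- x y d+yg≡xu = x , y * c′ , (begin
  (u * x + g * (y * c′)) % c     ≡⟨ cong (λ t → (t + g * (y * c′)) % c) (trans (*-comm u x) (sym d+yg≡xu)) ⟩
  (d + y * g + g * (y * c′)) % c ≡⟨ cong (_% c) (shuffle d y g c′) ⟩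
  (d + y * g * c) % c            ≡⟨ [m+kn]%n≡m%n d (y * g) c ⟩
  d % c                          ∎)
  where
  open ≡-Reasoning
  d = gcd u g
  shuffle : ∀ d y g c′ → d + y * g + g * (y * c′) ≡ d + y * g * suc c′
  shuffle = solve-∀
... | Bézout.-+ x y d+xu≡yg = x * c′ , y , (begin
  (u * (x * c′) + g * y) % c       ≡⟨ cong (λ t → (u * (x * c′) + t) % c) (trans (*-comm g y) (sym d+xu≡yg)) ⟩
  (u * (x * c′) + (d + x * u)) % c ≡⟨ cong (_% c) (shuffle d x u c′) ⟩
  (d + x * u * c) % c              ≡⟨ [m+kn]%n≡m%n d (x * u) c ⟩
  d % c                            ∎)
  where
  open ≡-Reasoning
  d = gcd u g
  shuffle : ∀ d x u c′ → u * (x * c′) + (d + x * u) ≡ d + x * u * suc c′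
  shuffle = solve-∀

gcd[m,gcd[n,o]]≡gcd[n,gcd[m,o]] : ∀ m n o → gcd m (gcd n o) ≡ gcd n (gcd m o)
gcd[m,gcd[n,o]]≡gcd[n,gcd[m,o]] m n o =
  trans (sym (gcd-assoc m n o)) (trans (cong (λ z → gcd z o) (gcd-comm m n)) (gcd-assoc n m o))

linearCombination-% : ∀ {n} c .{{_ : NonZero c}} (v : Fin n → ℕ) N → gcd c (gcdF v) ∣ N →
  ∃ λ (y : Fin n → ℕ) → sumF (λ k → v k * y k) % c ≡ N % c
linearCombination-% {zero} c@(suc _) v N c∣N =
  (λ ()) , sym (n∣m⇒m%n≡0 N c (subst (_∣ N) (gcd-identityʳ c) c∣N))
linearCombination-% {suc n} c v N g∣N
  with subst (_∣ N) (gcd[m,gcd[n,o]]≡gcd[n,gcd[m,o]] c (v Fin.zero) (gcdF (λ j → v (Fin.suc j)))) g∣N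
     | bézout-% (v Fin.zero) (gcd c (gcdF (λ j → v (Fin.suc j)))) c
... | divides t N≡t*d | X , Y , bézout
  with linearCombination-% c (λ j → v (Fin.suc j)) (gcd c (gcdF (λ j → v (Fin.suc j))) * (t * Y))
         (m∣m*n (t * Y))
... | y , Σwy≡GtY = y₀∷y , (begin
  (v₀ * (t * X) + sumF (λ j → v (Fin.suc j) * y j)) % c  ≡⟨ %-cong-+ˡ (v₀ * (t * X)) c Σwy≡GtY ⟩
  (v₀ * (t * X) + G * (t * Y)) % c                       ≡⟨ cong (_% c) (factor-t v₀ t X G Y) ⟩
  (t * (v₀ * X + G * Y)) % c                             ≡⟨ %-cong-*ˡ t c bézout ⟩
  (t * gcd v₀ G) % c                                     ≡⟨ cong (_% c) (sym N≡t*d) ⟩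
  N % c                                                  ∎)
  where
  open ≡-Reasoning
  v₀ = v Fin.zero
  G = gcd c (gcdF (λ j → v (Fin.suc j)))
  y₀∷y : Fin (suc n) → ℕ
  y₀∷y Fin.zero    = t * X
  y₀∷y (Fin.suc j) = y j
  factor-t : ∀ v₀ t X G Y → v₀ * (t * X) + G * (t * Y) ≡ t * (v₀ * X + G * Y)
  factor-t = solve-∀

%≡%⇒∣∸ : ∀ x y d .{{_ : NonZero d}} → x % d ≡ y % d → d ∣ x ∸ y
%≡%⇒∣∸ x y d x≡y = divides (x / d ∸ y / d) (begin
  x ∸ y                                     ≡⟨ cong₂ _∸_ (m≡m%n+[m/n]*n x d) (m≡m%n+[m/n]*n y d) ⟩
  (x % d + x / d * d) ∸ (y % d + y / d * d) ≡⟨ cong (λ z → (z + x / d * d) ∸ (y % d + y / d * d)) x≡y ⟩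
  (y % d + x / d * d) ∸ (y % d + y / d * d) ≡⟨ [m+n]∸[m+o]≡n∸o (y % d) _ _ ⟩
  x / d * d ∸ y / d * d                     ≡⟨ *-distribʳ-∸ d (x / d) (y / d) ⟨
  (x / d ∸ y / d) * d                       ∎)
  where open ≡-Reasoning

infix 4 _≈_mod_
_≈_mod_ : ℕ → ℕ → ℕ → Set
u ≈ w mod d = ∃ λ r → ∃ λ r′ → (d ∣ r) × (d ∣ r′) × (u + r ≡ w + r′)

≈mod-sym : ∀ {u w d} → u ≈ w mod d → w ≈ u mod d
≈mod-sym (r , r′ , d∣r , d∣r′ , eq) = r′ , r , d∣r′ , d∣r , sym eq

≈mod⇒∣ : ∀ {u w d} → u ≈ w mod d → d ∣ u → d ∣ w
≈mod⇒∣ {u} {w} {d} (r , r′ , d∣r , d∣r′ , eq) d∣u =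
  ∣m+n∣m⇒∣n (subst (d ∣_) (trans eq (+-comm w r′)) (∣m∣n⇒∣m+n d∣u d∣r)) d∣r′

%-cong-*-∣ : ∀ u w T k d .{{_ : NonZero T}} .{{_ : NonZero (T * k)}} .{{_ : NonZero d}} →
  u % T ≡ w % T → d ∣ T * k → (k * u) % d ≡ (k * w) % d
%-cong-*-∣ u w T k d u≡w d∣Tk = begin
  (k * u) % d            ≡⟨ cong (_% d) (*-comm k u) ⟩
  (u * k) % d            ≡⟨ m∣n⇒o%n%m≡o%m d (T * k) (u * k) d∣Tk ⟨
  (u * k) % (T * k) % d  ≡⟨ cong (_% d) (m%n*o≡m*o%[n*o] u T k) ⟨
  (u % T * k) % d        ≡⟨ cong (λ z → (z * k) % d) u≡w ⟩
  (w % T * k) % d        ≡⟨ cong (_% d) (m%n*o≡m*o%[n*o] w T k) ⟩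
  (w * k) % (T * k) % d  ≡⟨ m∣n⇒o%n%m≡o%m d (T * k) (w * k) d∣Tk ⟩
  (w * k) % d            ≡⟨ cong (_% d) (*-comm w k) ⟩
  (k * w) % d            ∎
  where open ≡-Reasoning

-- The representative of y mod T in [1, T] (with the junk value 1 for T = 0).
residue₁ : ℕ → ℕ → ℕ
residue₁ y zero     = 1
residue₁ y (suc T′) = suc ((y + T′) % suc T′)

1≤residue₁ : ∀ y T → 1 ≤ residue₁ y T
1≤residue₁ y zero    = s≤s z≤n
1≤residue₁ y (suc _) = s≤s z≤n

residue₁≤ : ∀ y T → 1 ≤ T → residue₁ y T ≤ T
residue₁≤ y (suc T′) _ = m%n<n (y + T′) (suc T′)

residue₁-% : ∀ y T .{{_ : NonZero T}} → residue₁ y T % T ≡ y % T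
residue₁-% y (suc T′) = begin
  (1 + (y + T′) % T) % T   ≡⟨ %-distribˡ-+ 1 ((y + T′) % T) T ⟩
  (1 % T + (y + T′) % T % T) % T ≡⟨ cong (λ z → (1 % T + z) % T) (m%n%n≡m%n (y + T′) T) ⟩
  (1 % T + (y + T′) % T) % T     ≡⟨ %-distribˡ-+ 1 (y + T′) T ⟨
  (1 + (y + T′)) % T       ≡⟨ cong (_% T) (trans (+-comm 1 (y + T′)) (trans (+-assoc y T′ 1) (cong (y +_) (+-comm T′ 1)))) ⟩
  (y + T) % T              ≡⟨ [m+n]%n≡m%n y T ⟩
  y % T                    ∎
  where
  open ≡-Reasoning
  T = suc T′

false≢true : false ≢ true
false≢true ()

∧≡true⇒ : ∀ {b e} → b ∧ e ≡ true → b ≡ true × e ≡ true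
∧≡true⇒ {true} {true} _ = refl , refl

⌊⌋-true⇒ : ∀ {P : Set} (P? : Dec P) → ⌊ P? ⌋ ≡ true → P
⌊⌋-true⇒ (yes p) _ = p

⌊⌋-true : ∀ {P : Set} (P? : Dec P) → P → ⌊ P? ⌋ ≡ true
⌊⌋-true (yes _)  _ = refl
⌊⌋-true (no ¬p) p = ⊥-elim (¬p p)

⌊⌋-false : ∀ {P : Set} (P? : Dec P) → ¬ P → ⌊ P? ⌋ ≡ false
⌊⌋-false (yes p) ¬p = ⊥-elim (¬p p)
⌊⌋-false (no _)  _  = refl

*-if-0 : ∀ b k x → k * (if b then x else 0) ≡ (if b then k * x else 0)
*-if-0 true  k x = refl
*-if-0 false k x = *-zeroʳ k

if-∧-0-≤ : ∀ b e x → (if b ∧ e then x else 0) ≤ (if b then x else 0)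
if-∧-0-≤ true  true  x = ≤-refl
if-∧-0-≤ true  false x = z≤n
if-∧-0-≤ false e     x = z≤n

∣-if-0 : ∀ {d} b x → (b ≡ true → d ∣ x) → d ∣ (if b then x else 0)
∣-if-0 true  x d∣x = d∣x refl
∣-if-0 false x _   = _ ∣0

if-⌊⌋-yes : ∀ {P : Set} {A : Set} (P? : Dec P) {x y : A} → P → (if ⌊ P? ⌋ then x else y) ≡ x
if-⌊⌋-yes P? {x} {y} p = cong (if_then x else y) (⌊⌋-true P? p)

if-⌊⌋-no : ∀ {P : Set} {A : Set} (P? : Dec P) {x y : A} → ¬ P → (if ⌊ P? ⌋ then x else y) ≡ y
if-⌊⌋-no P? {x} {y} ¬p = cong (if_then x else y) (⌊⌋-false P? ¬p)

-- Products over the two-element subsets of Fin n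

precedes : ∀ {n} → Fin n → Fin n → Bool
precedes i j = ⌊ toℕ i <? toℕ j ⌋

pairFactor : ∀ {n} → (Fin n → Fin n → Bool) → (Fin n → Fin n → ℕ) → Fin n → Fin n → ℕ
pairFactor Q f i j = if precedes i j ∧ Q i j then f i j else 1

pairProdBy : ∀ {n} → (Fin n → Fin n → Bool) → (Fin n → Fin n → ℕ) → ℕ
pairProdBy Q f = prodF (λ i → prodF (λ j → pairFactor Q f i j))

pairProdBy-cong : ∀ {n} {Q Q′ : Fin n → Fin n → Bool} (f : Fin n → Fin n → ℕ) →
  (∀ i j → toℕ i < toℕ j → Q i j ≡ Q′ i j) → pairProdBy Q f ≡ pairProdBy Q′ f
pairProdBy-cong {Q = Q} {Q′} f Q≡Q′ = prodF-cong (λ i → prodF-cong (λ j → factor≡ i j))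
  where
  factor≡ : ∀ i j → pairFactor Q f i j ≡ pairFactor Q′ f i j
  factor≡ i j with toℕ i <? toℕ j
  ... | yes i<j rewrite Q≡Q′ i j i<j = refl
  ... | no _    = refl

pairProdBy-split : ∀ {n} (Q R : Fin n → Fin n → Bool) (f : Fin n → Fin n → ℕ) →
  pairProdBy Q f ≡ pairProdBy (λ i j → Q i j ∧ R i j) f * pairProdBy (λ i j → Q i j ∧ not (R i j)) f
pairProdBy-split Q R f =
  trans (prodF-cong (λ i → trans (prodF-cong (λ j → split (precedes i j) (Q i j) (R i j) (f i j)))
                                 (prodF-* (λ j → pairFactor Q∧R f i j) (λ j → pairFactor Q∧¬R f i j))))
        (prodF-* (λ i → prodF (λ j → pairFactor Q∧R f i j)) (λ i → prodF (λ j → pairFactor Q∧¬R f i j)))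
  where
  Q∧R Q∧¬R : _ → _ → Bool
  Q∧R i j = Q i j ∧ R i j
  Q∧¬R i j = Q i j ∧ not (R i j)
  split : ∀ (b q r : Bool) x →
    (if b ∧ q then x else 1) ≡ (if b ∧ (q ∧ r) then x else 1) * (if b ∧ (q ∧ not r) then x else 1)
  split false q     r     x = refl
  split true  false r     x = refl
  split true  true  true  x = sym (*-identityʳ x)
  split true  true  false x = sym (+-identityʳ x)

pairFactor-chosen : ∀ {n} (Q : Fin n → Fin n → Bool) (f : Fin n → Fin n → ℕ) {i j} →
  toℕ i < toℕ j → Q i j ≡ true → pairFactor Q f i j ≡ f i j
pairFactor-chosen Q f {i} {j} i<j Qij with toℕ i <? toℕ j
... | yes _    = cong (if_then f i j else 1) Qij
... | no ¬i<j = ⊥-elim (¬i<j i<j)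

factor∣pairProdBy : ∀ {n} (Q : Fin n → Fin n → Bool) (f : Fin n → Fin n → ℕ) i j →
  toℕ i < toℕ j → Q i j ≡ true → f i j ∣ pairProdBy Q f
factor∣pairProdBy Q f i j i<j Qij = ∣-trans fij∣row (f∣prodF _ i)
  where
  fij∣row : f i j ∣ prodF (λ j′ → pairFactor Q f i j′)
  fij∣row = subst (_∣ prodF (λ j′ → pairFactor Q f i j′)) (pairFactor-chosen Q f i<j Qij) (f∣prodF _ j)

prime∣pairProdBy : ∀ {n r} (Q : Fin n → Fin n → Bool) (f : Fin n → Fin n → ℕ) →
  Prime r → r ∣ pairProdBy Q f →
  ∃ λ i → ∃ λ j → toℕ i < toℕ j × Q i j ≡ true × r ∣ f i j
prime∣pairProdBy {r = r} Q f pr r∣P with prime∣prodF _ pr r∣P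
... | i , r∣row with prime∣prodF _ pr r∣row
...   | j , r∣factor = i , j , prime∣factor r∣factor
  where
  prime∣factor : r ∣ pairFactor Q f i j → toℕ i < toℕ j × Q i j ≡ true × r ∣ f i j
  prime∣factor r∣ with toℕ i <? toℕ j | Q i j
  ... | yes i<j | true  = i<j , refl , r∣
  ... | yes _   | false = ⊥-elim (prime∤1 pr r∣)
  ... | no _    | _     = ⊥-elim (prime∤1 pr r∣)

1≤pairProdBy : ∀ {n} (Q : Fin n → Fin n → Bool) (f : Fin n → Fin n → ℕ) →
  (∀ i j → toℕ i < toℕ j → 1 ≤ f i j) → 1 ≤ pairProdBy Q f
1≤pairProdBy Q f 1≤f = 1≤prodF (λ i → 1≤prodF (λ j → 1≤factor i j))
  where
  1≤factor : ∀ i j → 1 ≤ pairFactor Q f i j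
  1≤factor i j with toℕ i <? toℕ j | Q i j
  ... | yes i<j | true  = 1≤f i j i<j
  ... | yes _   | false = s≤s z≤n
  ... | no _    | _     = s≤s z≤n

pairProdBy-singleton : ∀ {n} (Q : Fin n → Fin n → Bool) (f : Fin n → Fin n → ℕ) i j →
  toℕ i < toℕ j → Q i j ≡ true →
  (∀ x y → toℕ x < toℕ y → Q x y ≡ true → x ≡ i × y ≡ j) → pairProdBy Q f ≡ f i j
pairProdBy-singleton {n} Q f i j i<j Qij only =
  trans (prodF-single _ i (λ x x≢i → trans (prodF-cong (λ y → factor≡1 x y (λ { refl _ → x≢i refl })))
                                            (prodF-one n)))
        (trans (prodF-single _ j (λ y y≢j → factor≡1 i y (λ { _ refl → y≢j refl })))
               (pairFactor-chosen Q f i<j Qij))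
  where
  factor≡1 : ∀ x y → (x ≡ i → y ≡ j → ⊥) → pairFactor Q f x y ≡ 1
  factor≡1 x y ¬xy with toℕ x <? toℕ y | Q x y in Qxy
  ... | yes x<y | true  = ⊥-elim (¬xy (proj₁ (only x y x<y Qxy)) (proj₂ (only x y x<y Qxy)))
  ... | yes _   | false = refl
  ... | no _    | _     = refl

∃∉ : ∀ {n} (X : Subset n) → suc ∣ X ∣ ≤ n → ∃ λ u → u ∉ X
∃∉ {suc n} (true ∷ X) 1+∣X∣≤n with ∃∉ X (s≤s⁻¹ 1+∣X∣≤n)
... | u , u∉X = Fin.suc u , λ { (there u∈X) → u∉X u∈X }
∃∉ {suc n} (false ∷ X) _ = Fin.zero , λ ()

∃two∉ : ∀ {n} (X : Subset n) → 2 + ∣ X ∣ ≤ n →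
  ∃ λ u → ∃ λ w → toℕ u < toℕ w × u ∉ X × w ∉ X
∃two∉ {suc n} (true ∷ X) 2+∣X∣≤n with ∃two∉ X (s≤s⁻¹ 2+∣X∣≤n)
... | u , w , u<w , u∉X , w∉X =
  Fin.suc u , Fin.suc w , s≤s u<w , (λ { (there u∈X) → u∉X u∈X }) , (λ { (there w∈X) → w∉X w∈X })
∃two∉ {suc n} (false ∷ X) 2+∣X∣≤n with ∃∉ X (s≤s⁻¹ 2+∣X∣≤n)
... | w , w∉X = Fin.zero , Fin.suc w , s≤s z≤n , (λ ()) , (λ { (there w∈X) → w∉X w∈X })

-- The products of prime powers attached to pairs of indices

SamePair : ∀ {s} → Fin s → Fin s → Fin s → Fin s → Set
SamePair i j x y = (x ≡ i × y ≡ j) ⊎ (x ≡ j × y ≡ i)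

module PairPowers {s : ℕ} (m : ℕ) (p : Fin s → Fin s → ℕ)
  (p-sym : ∀ i j → p i j ≡ p j i)
  (p-prime : ∀ i j → i ≢ j → Prime (p i j))
  (p-injective : ∀ i j x y → i ≢ j → x ≢ y → p i j ≡ p x y → SamePair x y i j)
  where

  pp : Fin s → Fin s → ℕ
  pp i j = p i j ^ m

  _≈ᵇ_ : Fin s → Fin s → Bool
  x ≈ᵇ y = ⌊ toℕ x ≟ toℕ y ⌋

  avoids : Fin s → Fin s → Fin s → Bool
  avoids k x y = not (x ≈ᵇ k) ∧ not (y ≈ᵇ k)

  samePair : Fin s → Fin s → Fin s → Fin s → Bool
  samePair i j x y = (x ≈ᵇ i ∧ y ≈ᵇ j) ∨ (x ≈ᵇ j ∧ y ≈ᵇ i)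

  P : ℕ
  P = pairProdBy (λ _ _ → true) pp

  M : Fin s → ℕ
  M k = pairProd (λ x → not (x ≈ᵇ k)) pp

  Q : Fin s → Fin s → ℕ
  Q i j = pairProdBy (λ x y → not (samePair i j x y)) pp

  U : Fin s → Fin s → ℕ
  U i j = pairProdBy (λ x y → not (samePair i j x y) ∧ not (avoids i x y)) pp

  ≈ᵇ-refl : ∀ x → x ≈ᵇ x ≡ true
  ≈ᵇ-refl x = ⌊⌋-true (toℕ x ≟ toℕ x) refl

  ≈ᵇ⇒≡ : ∀ {x y} → x ≈ᵇ y ≡ true → x ≡ y
  ≈ᵇ⇒≡ e = Fin.toℕ-injective (⌊⌋-true⇒ _ e)

  ≢⇒≈ᵇ-false : ∀ {x y} → x ≢ y → x ≈ᵇ y ≡ false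
  ≢⇒≈ᵇ-false x≢y = ⌊⌋-false _ (λ e → x≢y (Fin.toℕ-injective e))

  samePair-true : ∀ {i j x y} → SamePair i j x y → samePair i j x y ≡ true
  samePair-true {i} {j} (inj₁ (refl , refl)) rewrite ≈ᵇ-refl i | ≈ᵇ-refl j = refl
  samePair-true {i} {j} (inj₂ (refl , refl)) rewrite ≈ᵇ-refl i | ≈ᵇ-refl j = Bool.∨-zeroʳ _

  samePair-false : ∀ {i j x y} → ¬ SamePair i j x y → samePair i j x y ≡ false
  samePair-false {i} {j} {x} {y} ¬same
    with x ≈ᵇ i in xi | y ≈ᵇ j in yj | x ≈ᵇ j in xj | y ≈ᵇ i in yi
  ... | true  | true  | _     | _     = ⊥-elim (¬same (inj₁ (≈ᵇ⇒≡ xi , ≈ᵇ⇒≡ yj)))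
  ... | _     | _     | true  | true  = ⊥-elim (¬same (inj₂ (≈ᵇ⇒≡ xj , ≈ᵇ⇒≡ yi)))
  ... | false | _     | false | _     = refl
  ... | false | _     | true  | false = refl
  ... | true  | false | false | _     = refl
  ... | true  | false | true  | false = refl

  samePair-sym : ∀ i j x y → samePair i j x y ≡ samePair j i x y
  samePair-sym i j x y = Bool.∨-comm (x ≈ᵇ i ∧ y ≈ᵇ j) (x ≈ᵇ j ∧ y ≈ᵇ i)

  avoids-true : ∀ {k x y} → x ≢ k → y ≢ k → avoids k x y ≡ true
  avoids-true x≢k y≢k rewrite ≢⇒≈ᵇ-false x≢k | ≢⇒≈ᵇ-false y≢k = refl

  avoids-false : ∀ {k x y} → k ≡ x ⊎ k ≡ y → avoids k x y ≡ false
  avoids-false {k} (inj₁ refl) rewrite ≈ᵇ-refl k = refl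
  avoids-false {k} {x} (inj₂ refl) rewrite ≈ᵇ-refl k = Bool.∧-zeroʳ (not (x ≈ᵇ k))

  avoids-true⇒ : ∀ {k x y} → avoids k x y ≡ true → x ≢ k × y ≢ k
  avoids-true⇒ {k} {x} {y} e =
    (λ x≡k → false≢true (trans (sym (avoids-false (inj₁ (sym x≡k)))) e)) ,
    (λ y≡k → false≢true (trans (sym (avoids-false (inj₂ (sym y≡k)))) e))

  prime∣pp⇒≡ : ∀ {r} x y → x ≢ y → Prime r → r ∣ pp x y → r ≡ p x y
  prime∣pp⇒≡ x y x≢y pr = prime∣^⇒≡ m pr (p-prime x y x≢y)

  1≤pp : ∀ x y → toℕ x < toℕ y → 1 ≤ pp x y
  1≤pp x y x<y = 1≤^ m (≤-trans (s≤s z≤n) (prime⇒2≤ (p-prime x y (Fin.<⇒≢ x<y))))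

  1≤pairProdBy-pp : ∀ R → 1 ≤ pairProdBy R pp
  1≤pairProdBy-pp R = 1≤pairProdBy R pp 1≤pp

  pp∣pairProdBy : ∀ (R : Fin s → Fin s → Bool) x y → x ≢ y →
    (toℕ x < toℕ y → R x y ≡ true) → (toℕ y < toℕ x → R y x ≡ true) → pp x y ∣ pairProdBy R pp
  pp∣pairProdBy R x y x≢y Rxy Ryx with <-cmp (toℕ x) (toℕ y)
  ... | tri< x<y _ _ = factor∣pairProdBy R pp x y x<y (Rxy x<y)
  ... | tri≈ _ x≡y _ = ⊥-elim (x≢y (Fin.toℕ-injective x≡y))
  ... | tri> _ _ y<x =
    subst (_∣ pairProdBy R pp) (cong (_^ m) (p-sym y x)) (factor∣pairProdBy R pp y x y<x (Ryx y<x))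

  pp∣M : ∀ k x y → x ≢ y → x ≢ k → y ≢ k → pp x y ∣ M k
  pp∣M k x y x≢y x≢k y≢k =
    pp∣pairProdBy (avoids k) x y x≢y (λ _ → avoids-true x≢k y≢k) (λ _ → avoids-true y≢k x≢k)

  pp∣U : ∀ i j x y → x ≢ y → i ≡ x ⊎ i ≡ y → ¬ SamePair i j x y → pp x y ∣ U i j
  pp∣U i j x y x≢y i∈xy ¬same =
    pp∣pairProdBy _ x y x≢y (λ _ → selected ¬same i∈xy) (λ _ → selected ¬same′ (swap i∈xy))
    where
    selected : ∀ {u w} → ¬ SamePair i j u w → i ≡ u ⊎ i ≡ w →
      not (samePair i j u w) ∧ not (avoids i u w) ≡ true
    selected ¬s i∈uw rewrite samePair-false ¬s | avoids-false i∈uw = refl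
    swap : ∀ {A B : Set} → A ⊎ B → B ⊎ A
    swap (inj₁ a) = inj₂ a
    swap (inj₂ b) = inj₁ b
    ¬same′ : ¬ SamePair i j y x
    ¬same′ (inj₁ (y≡i , x≡j)) = ¬same (inj₂ (x≡j , y≡i))
    ¬same′ (inj₂ (y≡j , x≡i)) = ¬same (inj₁ (x≡i , y≡j))

  prime∣M : ∀ {r} k → Prime r → r ∣ M k →
    ∃ λ x → ∃ λ y → toℕ x < toℕ y × x ≢ k × y ≢ k × r ≡ p x y
  prime∣M k pr r∣M with prime∣pairProdBy (avoids k) pp pr r∣M
  ... | x , y , x<y , avoid , r∣pp =
    x , y , x<y , proj₁ (avoids-true⇒ avoid) , proj₂ (avoids-true⇒ avoid) ,
    prime∣pp⇒≡ x y (Fin.<⇒≢ x<y) pr r∣pp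

  p∤M : ∀ i j → i ≢ j → ¬ (p i j ∣ M i)
  p∤M i j i≢j p∣M with prime∣M i (p-prime i j i≢j) p∣M
  ... | x , y , x<y , x≢i , y≢i , p≡ with p-injective x y i j (Fin.<⇒≢ x<y) i≢j (sym p≡)
  ...   | inj₁ (x≡i , _) = x≢i x≡i
  ...   | inj₂ (_ , y≡i) = y≢i y≡i

  p∤Q : ∀ i j → i ≢ j → ¬ (p i j ∣ Q i j)
  p∤Q i j i≢j p∣Q with prime∣pairProdBy _ pp (p-prime i j i≢j) p∣Q
  ... | x , y , x<y , ¬same , p∣pp =
    false≢true (trans (sym (cong not (samePair-true same))) ¬same)
    where
    x≢y = Fin.<⇒≢ x<y
    same : SamePair i j x y
    same = p-injective x y i j x≢y i≢j (sym (prime∣pp⇒≡ x y x≢y (p-prime i j i≢j) p∣pp))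

  M*-powGcd>1 : ∀ (x : Fin s → ℕ) (X : Subset s) → 2 + ∣ X ∣ ≤ s → PowGcdGtOne m X (λ k → M k * x k)
  M*-powGcd>1 x X 2+∣X∣≤s =
    let u , w , u<w , u∉X , w∉X = ∃two∉ X 2+∣X∣≤s in
    p u w , prime⇒2≤ (p-prime u w (Fin.<⇒≢ u<w)) ,
    λ k k∈X → ∣m⇒∣m*n (x k) (pp∣M k u w (Fin.<⇒≢ u<w) (λ { refl → u∉X k∈X }) (λ { refl → w∉X k∈X }))

  Q≡M*U : ∀ i j → Q i j ≡ M i * U i j
  Q≡M*U i j =
    trans (pairProdBy-split (λ x y → not (samePair i j x y)) (avoids i) pp)
          (cong (_* U i j) (pairProdBy-cong pp (λ x y _ → absorb (x ≈ᵇ i) (y ≈ᵇ i) (y ≈ᵇ j) (x ≈ᵇ j))))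
    where
    absorb : ∀ xi yi yj xj → not ((xi ∧ yj) ∨ (xj ∧ yi)) ∧ (not xi ∧ not yi) ≡ not xi ∧ not yi
    absorb true  yi    yj xj    = Bool.∧-zeroʳ _
    absorb false true  yj xj    = Bool.∧-zeroʳ _
    absorb false false yj true  = refl
    absorb false false yj false = refl

  Q-sym : ∀ i j → Q i j ≡ Q j i
  Q-sym i j = pairProdBy-cong pp (λ x y _ → cong not (samePair-sym i j x y))

  samePair-true⇒ : ∀ {i j x y} → samePair i j x y ≡ true → SamePair i j x y
  samePair-true⇒ {i} {j} {x} {y} same
    with x ≈ᵇ i in xi | y ≈ᵇ j in yj | x ≈ᵇ j in xj | y ≈ᵇ i in yi
  ... | true  | true  | _     | _     = inj₁ (≈ᵇ⇒≡ xi , ≈ᵇ⇒≡ yj)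
  ... | _     | _     | true  | true  = inj₂ (≈ᵇ⇒≡ xj , ≈ᵇ⇒≡ yi)
  ... | false | _     | false | _     = ⊥-elim (false≢true same)
  ... | false | _     | true  | false = ⊥-elim (false≢true same)
  ... | true  | false | false | _     = ⊥-elim (false≢true same)
  ... | true  | false | true  | false = ⊥-elim (false≢true same)

  P≡pp*Q : ∀ i j → toℕ i < toℕ j → P ≡ pp i j * Q i j
  P≡pp*Q i j i<j =
    trans (pairProdBy-split (λ _ _ → true) (samePair i j) pp)
          (cong (_* Q i j) (pairProdBy-singleton (samePair i j) pp i j i<j
                              (samePair-true {i} {j} (inj₁ (refl , refl))) only))
    where
    only : ∀ x y → toℕ x < toℕ y → samePair i j x y ≡ true → x ≡ i × y ≡ j
    only x y x<y same with samePair-true⇒ same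
    ... | inj₁ x≡i,y≡j = x≡i,y≡j
    ... | inj₂ (refl , refl) = ⊥-elim (<-asym i<j x<y)

module PairTerms {s : ℕ} (m : ℕ) (1≤m : 1 ≤ m) (a : Fin s → ℕ) (1≤a : ∀ i → 1 ≤ a i)
  (p : Fin s → Fin s → ℕ)
  (p-sym : ∀ i j → p i j ≡ p j i)
  (p-prime : ∀ i j → i ≢ j → Prime (p i j))
  (p-injective : ∀ i j x y → i ≢ j → x ≢ y → p i j ≡ p x y → SamePair x y i j)
  where

  open PairPowers m p p-sym p-prime p-injective public

  g : Fin s → Fin s → ℕ
  g i j = gcd (a i) (a j)

  instance
    g-nonZero : ∀ {i j} → NonZero (g i j)
    g-nonZero {i} {j} = ≢-nonZero (gcd[m,n]≢0 (a i) (a j) (inj₁ (λ aᵢ≡0 → <⇒≢ (1≤a i) (sym aᵢ≡0))))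

  α β : Fin s → Fin s → ℕ
  α i j = a i / g i j
  β i j = a j / g i j

  α*g≡a : ∀ i j → α i j * g i j ≡ a i
  α*g≡a i j = m/n*n≡m (gcd[m,n]∣m (a i) (a j))

  β*g≡a : ∀ i j → β i j * g i j ≡ a j
  β*g≡a i j = m/n*n≡m (gcd[m,n]∣n (a i) (a j))

  a*α≡a*β : ∀ i j → a j * α i j ≡ a i * β i j
  a*α≡a*β i j = begin
    a j * α i j             ≡⟨ cong (_* α i j) (β*g≡a i j) ⟨
    β i j * g i j * α i j   ≡⟨ x*y*z≡z*y*x (β i j) (g i j) (α i j) ⟩
    α i j * g i j * β i j   ≡⟨ cong (_* β i j) (α*g≡a i j) ⟩
    a i * β i j             ∎
    where
    open ≡-Reasoning
    x*y*z≡z*y*x : ∀ x y z → x * y * z ≡ z * y * x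
    x*y*z≡z*y*x = solve-∀

  1≤β : ∀ i j → 1 ≤ β i j
  1≤β i j = n≢0⇒n>0 (λ β≡0 → <⇒≢ (1≤a j) (sym (trans (sym (β*g≡a i j)) (cong (_* g i j) β≡0))))

  c : Fin s → ℕ
  c k = a k * M k

  L A B : Fin s → Fin s → ℕ
  L i j = a i * β i j * Q i j
  A i j = β i j * U i j
  B i j = α i j * U j i

  1≤M : ∀ k → 1 ≤ M k
  1≤M k = 1≤pairProdBy-pp (avoids k)

  1≤c : ∀ k → 1 ≤ c k
  1≤c k = *-mono-≤ (1≤a k) (1≤M k)

  1≤A : ∀ i j → 1 ≤ A i j
  1≤A i j = *-mono-≤ (1≤β i j) (1≤pairProdBy-pp _)

  c*A≡L : ∀ i j → c i * A i j ≡ L i j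
  c*A≡L i j = begin
    a i * M i * (β i j * U i j)  ≡⟨ x*y*[z*w]≡x*z*[y*w] (a i) (M i) (β i j) (U i j) ⟩
    a i * β i j * (M i * U i j)  ≡⟨ cong (a i * β i j *_) (Q≡M*U i j) ⟨
    a i * β i j * Q i j          ∎
    where
    open ≡-Reasoning
    x*y*[z*w]≡x*z*[y*w] : ∀ x y z w → x * y * (z * w) ≡ x * z * (y * w)
    x*y*[z*w]≡x*z*[y*w] = solve-∀

  c*B≡L : ∀ i j → c j * B i j ≡ L i j
  c*B≡L i j = begin
    a j * M j * (α i j * U j i)  ≡⟨ x*y*[z*w]≡x*z*[y*w] (a j) (M j) (α i j) (U j i) ⟩
    a j * α i j * (M j * U j i)  ≡⟨ cong₂ _*_ (a*α≡a*β i j) (sym (Q≡M*U j i)) ⟩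
    a i * β i j * Q j i          ≡⟨ cong (a i * β i j *_) (Q-sym j i) ⟩
    a i * β i j * Q i j          ∎
    where
    open ≡-Reasoning
    x*y*[z*w]≡x*z*[y*w] : ∀ x y z w → x * y * (z * w) ≡ x * z * (y * w)
    x*y*[z*w]≡x*z*[y*w] = solve-∀

  -- Since p i j divides neither Q i j nor Q j i, it would divide both a i / g i j and a j / g i j.
  p∣A⇒p∤B : ∀ i j → i ≢ j → p i j ∣ A i j → ¬ (p i j ∣ B i j)
  p∣A⇒p∤B i j i≢j p∣A p∣B = prime∤1 pr (GCD.greatest (GCD-/gcd (a i) (a j)) (p∣α , p∣β))
    where
    pr = p-prime i j i≢j
    p∣β : p i j ∣ β i j
    p∣β with euclidsLemma (β i j) (U i j) pr p∣A
    ... | inj₁ p∣β = p∣β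
    ... | inj₂ p∣U = ⊥-elim (p∤Q i j i≢j (subst (p i j ∣_) (sym (Q≡M*U i j)) (∣n⇒∣m*n (M i) p∣U)))
    p∣α : p i j ∣ α i j
    p∣α with euclidsLemma (α i j) (U j i) pr p∣B
    ... | inj₁ p∣α = p∣α
    ... | inj₂ p∣U = ⊥-elim (p∤Q i j i≢j (subst (p i j ∣_) (trans (sym (Q≡M*U j i)) (Q-sym j i)) (∣n⇒∣m*n (M j) p∣U)))

-- Index conventions of Defs: small indices toℕ k < q are the paper's [s-2], pen q is s-1, lst q is s.
module Indices (q : ℕ) where

  toℕ-pen : toℕ (pen q) ≡ q
  toℕ-pen = trans (Fin.toℕ-inject₁ (fromℕ q)) (Fin.toℕ-fromℕ q)

  toℕ-lst : toℕ (lst q) ≡ suc q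
  toℕ-lst = Fin.toℕ-fromℕ (suc q)

  toℕ≤1+q : ∀ (k : Fin (2 + q)) → toℕ k ≤ suc q
  toℕ≤1+q k = s≤s⁻¹ (Fin.toℕ<n k)

  ≡pen : ∀ {k} → toℕ k ≡ q → k ≡ pen q
  ≡pen e = Fin.toℕ-injective (trans e (sym toℕ-pen))

  ≡lst : ∀ {k} → toℕ k ≡ suc q → k ≡ lst q
  ≡lst e = Fin.toℕ-injective (trans e (sym toℕ-lst))

  ≤q⊎≡lst : ∀ k → toℕ k ≤ q ⊎ k ≡ lst q
  ≤q⊎≡lst k with m≤n⇒m<n∨m≡n (toℕ≤1+q k)
  ... | inj₁ k<1+q  = inj₁ (s≤s⁻¹ k<1+q)
  ... | inj₂ k≡1+q = inj₂ (≡lst k≡1+q)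

  ≤q⇒<q⊎≡pen : ∀ {k} → toℕ k ≤ q → toℕ k < q ⊎ k ≡ pen q
  ≤q⇒<q⊎≡pen k≤q with m≤n⇒m<n∨m≡n k≤q
  ... | inj₁ k<q = inj₁ k<q
  ... | inj₂ k≡q = inj₂ (≡pen k≡q)

  small : Fin (2 + q) → Bool
  small k = ⌊ toℕ k <? q ⌋

  onSmall : (Fin (2 + q) → ℕ) → Fin (2 + q) → ℕ
  onSmall f k = if small k then f k else 0

  sumF-pick : ∀ (f : Fin (2 + q) → ℕ) N j → toℕ j ≡ N →
    sumF (λ k → if ⌊ toℕ k ≟ N ⌋ then f k else 0) ≡ f j
  sumF-pick f N j j≡N =
    trans (sumF-single _ j (λ k k≢j → if-⌊⌋-no (toℕ k ≟ N) {f k} (λ k≡N → k≢j (Fin.toℕ-injective (trans k≡N (sym j≡N))))))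
          (if-⌊⌋-yes (toℕ j ≟ N) {f j} j≡N)

  sumF-small+pen+lst : ∀ (f : Fin (2 + q) → ℕ) → sumF f ≡ sumF (onSmall f) + f (pen q) + f (lst q)
  sumF-small+pen+lst f =
    trans (sumF-cong split)
          (trans (sumF-+ (λ k → onSmall f k + atq k) atq+1)
                 (cong₂ _+_ (trans (sumF-+ (onSmall f) atq) (cong (sumF (onSmall f) +_) (sumF-pick f q (pen q) toℕ-pen)))
                            (sumF-pick f (suc q) (lst q) toℕ-lst)))
    where
    atq atq+1 : Fin (2 + q) → ℕ
    atq k = if ⌊ toℕ k ≟ q ⌋ then f k else 0
    atq+1 k = if ⌊ toℕ k ≟ suc q ⌋ then f k else 0
    split : ∀ k → f k ≡ onSmall f k + atq k + atq+1 k
    split k with toℕ k <? q | toℕ k ≟ q | toℕ k ≟ suc q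
    ... | yes k<q | yes k≡q | _        = ⊥-elim (<-irrefl k≡q k<q)
    ... | yes k<q | no _    | yes k≡q+1 = ⊥-elim (<-asym k<q (subst (q <_) (sym k≡q+1) (n<1+n q)))
    ... | yes _   | no _    | no _     = sym (trans (+-identityʳ _) (+-identityʳ _))
    ... | no _    | yes k≡q | yes k≡q+1 = ⊥-elim (<-irrefl (trans (sym k≡q) k≡q+1) (n<1+n q))
    ... | no _    | yes _   | no _     = sym (+-identityʳ _)
    ... | no _    | no _    | yes _    = refl
    ... | no k≮q  | no k≢q  | no k≢q+1 =
      ⊥-elim (k≢q+1 (≤-antisym (toℕ≤1+q k) (≤∧≢⇒< (≮⇒≥ k≮q) (λ q≡k → k≢q (sym q≡k)))))

module Setting (m q : ℕ) (1≤m : 1 ≤ m)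
  (a : Fin (2 + q) → ℕ) (1≤a : ∀ i → 1 ≤ a i)
  (gcd[a₁…aₛ₋₁]≡1 : gcdF (λ (i : Fin (2 + q)) → restrictTo (toℕ i) q (a i)) ≡ 1)
  (p : Fin (2 + q) → Fin (2 + q) → ℕ)
  (p-sym : ∀ i j → p i j ≡ p j i)
  (p-prime : ∀ i j → i ≢ j → Prime (p i j))
  (p-injective : ∀ i j x y → i ≢ j → x ≢ y → p i j ≡ p x y → SamePair x y i j)
  (p∤gcd : ∀ i j → i ≢ j → toℕ i ≤ q → toℕ j ≤ q → ¬ (p i j ∣ gcd (a i) (a j)))
  (p∤a : ∀ i → toℕ i ≤ q → ¬ (p i (lst q) ∣ a i))
  where

  open PairTerms m 1≤m a 1≤a p p-sym p-prime p-injective public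
  open Indices q public

  cp : ℕ
  cp = c (pen q)

  instance
    cp-nonZero : NonZero cp
    cp-nonZero = >-nonZero (1≤c (pen q))

  p∣c⇒p∣a : ∀ x y → x ≢ y → p x y ∣ c x → p x y ∣ a x
  p∣c⇒p∣a x y x≢y p∣c with euclidsLemma (a x) (M x) (p-prime x y x≢y) p∣c
  ... | inj₁ p∣a = p∣a
  ... | inj₂ p∣M = ⊥-elim (p∤M x y x≢y p∣M)

  p∤all-c : ∀ x y → toℕ x < toℕ y → ¬ (∀ k → toℕ k ≤ q → p x y ∣ c k)
  p∤all-c x y x<y p∣c = [ p∤gcd-xy , (λ { refl → p∤a x x≤q p∣aₓ }) ]′ (≤q⊎≡lst y)
    where
    x≢y = Fin.<⇒≢ x<y
    x≤q : toℕ x ≤ q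
    x≤q = s≤s⁻¹ (≤-trans x<y (toℕ≤1+q y))
    p∣aₓ : p x y ∣ a x
    p∣aₓ = p∣c⇒p∣a x y x≢y (p∣c x x≤q)
    p∤gcd-xy : toℕ y ≤ q → ⊥
    p∤gcd-xy y≤q = p∤gcd x y x≢y x≤q y≤q (gcd-greatest p∣aₓ p∣a_y)
      where
      p∣a_y : p x y ∣ a y
      p∣a_y = subst (_∣ a y) (p-sym y x)
                (p∣c⇒p∣a y x (λ y≡x → x≢y (sym y≡x)) (subst (_∣ c y) (p-sym x y) (p∣c y y≤q)))

  -- A prime dividing c k for all k ∈ [s-1] cannot divide any of these M k, so it divides every
  -- such a k, contradicting (a₁, …, aₛ₋₁) = 1.
  prime∤all-c : ∀ {r} → Prime r → ¬ (∀ k → toℕ k ≤ q → r ∣ c k)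
  prime∤all-c {r} pr r∣c = prime∤1 pr (subst (r ∣_) gcd[a₁…aₛ₋₁]≡1 (gcdF-greatest _ r∣restricted))
    where
    r∣a : ∀ k → toℕ k ≤ q → r ∣ a k
    r∣a k k≤q = decidable-stable (r ∣? a k) (λ r∤a → [ r∤a , r∤M ]′ (euclidsLemma (a k) (M k) pr (r∣c k k≤q)))
      where
      r∤M : ¬ (r ∣ M k)
      r∤M r∣M = let x , y , x<y , _ , _ , r≡p = prime∣M k pr r∣M in
        p∤all-c x y x<y (λ k k≤q → subst (_∣ c k) r≡p (r∣c k k≤q))
    r∣restricted : ∀ i → r ∣ restrictTo (toℕ i) q (a i)
    r∣restricted i with toℕ i ≤? q
    ... | yes i≤q = r∣a i i≤q
    ... | no _    = r ∣0

  gcd[cp,small-c]≡1 : gcd cp (gcdF (onSmall c)) ≡ 1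
  gcd[cp,small-c]≡1 = ≢0⇒primeFree⇒≡1 _ (λ G≡0 → <⇒≢ (1≤c (pen q)) (sym (gcd[m,n]≡0⇒m≡0 G≡0)))
    (λ pr r∣G → prime∤all-c pr (λ k k≤q → [ (r∣small r∣G) , (λ { refl → ∣-trans r∣G (gcd[m,n]∣m cp _) }) ]′
                                                (≤q⇒<q⊎≡pen k≤q)))
    where
    r∣small : ∀ {r k} → r ∣ gcd cp (gcdF (onSmall c)) → toℕ k < q → r ∣ c k
    r∣small {k = k} r∣G k<q =
      subst (_ ∣_) (if-⌊⌋-yes (toℕ k <? q) k<q)
        (∣-trans r∣G (∣-trans (gcd[m,n]∣n cp _) (gcdF-∣ (onSmall c) k)))

  innerPair : Fin (2 + q) → Fin (2 + q) → Bool
  innerPair i k = precedes i k ∧ ⌊ toℕ k ≤? q ⌋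

  innerPair⇒< : ∀ i j → innerPair i j ≡ true → toℕ i < toℕ j
  innerPair⇒< i j inner = ⌊⌋-true⇒ (toℕ i <? toℕ j) (proj₁ (∧≡true⇒ {precedes i j} inner))

  innerPair-lst : ∀ i → innerPair i (lst q) ≡ false
  innerPair-lst i =
    trans (cong (precedes i (lst q) ∧_) (⌊⌋-false (toℕ (lst q) ≤? q) (λ lst≤q → 1+n≰n (subst (_≤ q) toℕ-lst lst≤q))))
          (Bool.∧-zeroʳ _)

  precedes-lst : ∀ j → precedes (lst q) j ≡ false
  precedes-lst j =
    ⌊⌋-false (toℕ (lst q) <? toℕ j) (λ lst<j → 1+n≰n (<-≤-trans (subst (_< toℕ j) toℕ-lst lst<j) (toℕ≤1+q j)))

  slack : Fin (2 + q) → ℕ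
  slack k = sumF (λ i → if innerPair i k then B i k else 0)

  R : ℕ
  R = sumF (λ k → c k * slack k)

  Lpen : ℕ
  Lpen = sumF (onSmall (λ k → L k (pen q)))

  lcm≡a*β : ∀ k l → (a k * a l) ÷ gcd (a k) (a l) ≡ a k * β k l
  lcm≡a*β k l = trans (÷≡/ (a k * a l) (g k l)) (*-/-assoc (a k) (gcd[m,n]∣n (a k) (a l)))

  P÷pp≡Q : ∀ k l → toℕ k < toℕ l → P ÷ pp k l ≡ Q k l
  P÷pp≡Q k l k<l = begin
    P ÷ pp k l            ≡⟨ ÷≡/ P (pp k l) ⟩
    P / pp k l            ≡⟨ cong (_/ pp k l) (trans (P≡pp*Q k l k<l) (*-comm (pp k l) (Q k l))) ⟩
    Q k l * pp k l / pp k l ≡⟨ m*n/n≡m (Q k l) (pp k l) ⟩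
    Q k l                 ∎
    where
    open ≡-Reasoning
    instance _ = >-nonZero (1≤pp k l k<l)

  2P÷pp≡2Q : ∀ k l → toℕ k < toℕ l → (2 * P) ÷ pp k l ≡ 2 * Q k l
  2P÷pp≡2Q k l k<l = begin
    (2 * P) ÷ pp k l                ≡⟨ ÷≡/ (2 * P) (pp k l) ⟩
    (2 * P) / pp k l                ≡⟨ cong (_/ pp k l) (cong (2 *_) (P≡pp*Q k l k<l)) ⟩
    (2 * (pp k l * Q k l)) / pp k l ≡⟨ cong (_/ pp k l) (2*[x*y]≡2*y*x (pp k l) (Q k l)) ⟩
    2 * Q k l * pp k l / pp k l     ≡⟨ m*n/n≡m (2 * Q k l) (pp k l) ⟩
    2 * Q k l                       ∎
    where
    open ≡-Reasoning
    instance _ = >-nonZero (1≤pp k l k<l)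
    2*[x*y]≡2*y*x : ∀ x y → 2 * (x * y) ≡ 2 * y * x
    2*[x*y]≡2*y*x = solve-∀

  M-pen : pairProd (λ i → not ⌊ toℕ i ≟ q ⌋) pp ≡ M (pen q)
  M-pen = pairProdBy-cong pp (λ i j _ → cong₂ _∧_ (≟pen i) (≟pen j))
    where
    ≟pen : ∀ i → not ⌊ toℕ i ≟ q ⌋ ≡ not (i ≈ᵇ pen q)
    ≟pen i = cong (λ z → not ⌊ toℕ i ≟ z ⌋) (sym toℕ-pen)

  M-lst : pairProd (λ i → ⌊ toℕ i <? suc q ⌋) pp ≡ M (lst q)
  M-lst = pairProdBy-cong pp (λ i j _ → cong₂ _∧_ (<1+q i) (<1+q j))
    where
    <1+q : ∀ i → ⌊ toℕ i <? suc q ⌋ ≡ not (i ≈ᵇ lst q)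
    <1+q i with toℕ i <? suc q | toℕ i ≟ toℕ (lst q)
    ... | yes i<1+q | yes i≡lst = ⊥-elim (<-irrefl (trans i≡lst toℕ-lst) i<1+q)
    ... | yes _     | no _      = refl
    ... | no _      | yes _     = refl
    ... | no i≮1+q  | no i≢lst  =
      ⊥-elim (i≮1+q (≤∧≢⇒< (toℕ≤1+q i) (λ i≡1+q → i≢lst (trans i≡1+q (sym toℕ-lst)))))

  row inner : Fin (2 + q) → ℕ
  row i = sumF (λ k → if innerPair i k then L i k else 0)
  inner i = sumF (λ l → if precedes i l ∧ small l then L i l else 0)

  R≡Σrow : R ≡ sumF row
  R≡Σrow =
    trans (sumF-cong (λ k → trans (sym (sumF-*ˡ (c k) (λ i → if innerPair i k then B i k else 0)))
                                  (sumF-cong (λ i → trans (*-if-0 (innerPair i k) (c k) (B i k))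
                                                          (cong (if innerPair i k then_else 0) (c*B≡L i k))))))
          (sumF-comm (λ k i → if innerPair i k then L i k else 0))

  row≡inner+Lpen : ∀ i → row i ≡ inner i + (if precedes i (pen q) then L i (pen q) else 0)
  row≡inner+Lpen i =
    trans (sumF-cong (λ l → split (precedes i l) (toℕ l) (L i l)))
          (trans (sumF-+ (λ l → if precedes i l ∧ small l then L i l else 0)
                         (λ l → if ⌊ toℕ l ≟ q ⌋ then (if precedes i l then L i l else 0) else 0))
                 (cong (inner i +_) (sumF-pick (λ l → if precedes i l then L i l else 0) q (pen q) toℕ-pen)))
    where
    split : ∀ b l X → (if b ∧ ⌊ l ≤? q ⌋ then X else 0) ≡
      (if b ∧ ⌊ l <? q ⌋ then X else 0) + (if ⌊ l ≟ q ⌋ then (if b then X else 0) else 0)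
    split false l X with l ≟ q
    ... | yes _ = refl
    ... | no _  = refl
    split true l X with l ≤? q | l <? q | l ≟ q
    ... | yes _   | yes l<q | yes l≡q = ⊥-elim (<-irrefl l≡q l<q)
    ... | yes _   | yes _   | no _    = sym (+-identityʳ X)
    ... | yes _   | no _    | yes _   = refl
    ... | yes l≤q | no l≮q  | no l≢q  = ⊥-elim (l≮q (≤∧≢⇒< l≤q l≢q))
    ... | no l≰q  | yes l<q | _       = ⊥-elim (l≰q (<⇒≤ l<q))
    ... | no l≰q  | no _    | yes l≡q = ⊥-elim (l≰q (≤-reflexive l≡q))
    ... | no _    | no _    | no _    = refl

  boundSummand inner-÷ : Fin (2 + q) → ℕ
  boundSummand k = if small k then
      ((a k * a (pen q)) ÷ gcd (a k) (a (pen q))) * ((2 * P) ÷ (p k (pen q) ^ m)) + inner-÷ k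
    else 0
  inner-÷ k = sumF (λ l → if precedes k l ∧ small l then
      ((a k * a l) ÷ gcd (a k) (a l)) * (P ÷ (p k l ^ m))
    else 0)

  inner-÷≡inner : ∀ k → inner-÷ k ≡ inner k
  inner-÷≡inner k = sumF-cong term≡
    where
    term≡ : ∀ l → (if precedes k l ∧ small l then ((a k * a l) ÷ gcd (a k) (a l)) * (P ÷ (p k l ^ m)) else 0)
                ≡ (if precedes k l ∧ small l then L k l else 0)
    term≡ l with toℕ k <? toℕ l
    ... | no _    = refl
    ... | yes k<l = cong (if small l then_else 0) (cong₂ _*_ (lcm≡a*β k l) (P÷pp≡Q k l k<l))

  boundSummand≡ : ∀ k → boundSummand k ≡ onSmall (λ k → L k (pen q)) k + row k
  boundSummand≡ k with toℕ k <? q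
  ... | yes k<q = begin
    lcm * 2P÷pp + inner-÷ k                  ≡⟨ cong₂ _+_ (cong₂ _*_ (lcm≡a*β k (pen q)) (2P÷pp≡2Q k (pen q) k<pen))
                                                              (inner-÷≡inner k) ⟩
    a k * β k (pen q) * (2 * Q k (pen q)) + inner k ≡⟨ shuffle (a k * β k (pen q)) (Q k (pen q)) (inner k) ⟩
    Lₖ + (inner k + Lₖ)                      ≡⟨ cong (λ z → Lₖ + (inner k + z)) (if-⌊⌋-yes (toℕ k <? toℕ (pen q)) k<pen) ⟨
    Lₖ + (inner k + (if precedes k (pen q) then Lₖ else 0)) ≡⟨ cong (Lₖ +_) (row≡inner+Lpen k) ⟨
    Lₖ + row k                               ∎
    where
    open ≡-Reasoning
    Lₖ = L k (pen q)
    lcm = (a k * a (pen q)) ÷ gcd (a k) (a (pen q))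
    2P÷pp = (2 * P) ÷ (p k (pen q) ^ m)
    k<pen : toℕ k < toℕ (pen q)
    k<pen = subst (toℕ k <_) (sym toℕ-pen) k<q
    shuffle : ∀ x y z → x * (2 * y) + z ≡ x * y + (z + x * y)
    shuffle = solve-∀
  ... | no k≮q = sym (trans (row≡inner+Lpen k) (cong₂ _+_ inner≡0 (if-⌊⌋-no (toℕ k <? toℕ (pen q)) k≮pen)))
    where
    k≮pen : ¬ toℕ k < toℕ (pen q)
    k≮pen k<pen = k≮q (subst (toℕ k <_) toℕ-pen k<pen)
    inner≡0 : inner k ≡ 0
    inner≡0 = trans (sumF-cong term≡0) (sumF-zero (2 + q))
      where
      term≡0 : ∀ l → (if precedes k l ∧ small l then L k l else 0) ≡ 0
      term≡0 l with toℕ k <? toℕ l | toℕ l <? q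
      ... | yes k<l | yes l<q = ⊥-elim (k≮q (<-trans k<l l<q))
      ... | yes _   | no _    = refl
      ... | no _    | _       = refl

  bound≡ : bound m q a p ≡ cp + c (lst q) + (Lpen + R)
  bound≡ = cong₂ _+_ (cong₂ _+_ (cong (a (pen q) *_) M-pen) (cong (a (lst q) *_) M-lst))
                     (trans (sumF-cong boundSummand≡)
                            (trans (sumF-+ (onSmall (λ k → L k (pen q))) row) (cong (Lpen +_) (sym R≡Σrow))))

  T : Fin (2 + q) → ℕ
  T k = A k (pen q)

  cp∣T*c : ∀ k → cp ∣ T k * c k
  cp∣T*c k = divides (B k (pen q)) (begin
    T k * c k          ≡⟨ *-comm (T k) (c k) ⟩
    c k * A k (pen q)  ≡⟨ c*A≡L k (pen q) ⟩
    L k (pen q)        ≡⟨ c*B≡L k (pen q) ⟨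
    cp * B k (pen q)   ≡⟨ *-comm cp _ ⟩
    B k (pen q) * cp   ∎)
    where open ≡-Reasoning

  -- Solve Σ_{k<q} c k z k ≡ N₁ (mod cp) with 1 ≤ z k ≤ T k (possible since cp is coprime to these
  -- c k and cp ∣ T k * c k), then let z (pen q) absorb the difference; z (lst q) = 1.
  module BaseSolution (n : ℕ) (bound≤n : cp + c (lst q) + (Lpen + R) ≤ n) where

    N₁ : ℕ
    N₁ = n ∸ (c (lst q) + R)

    cp+Lpen+[clst+R]≤n : cp + Lpen + (c (lst q) + R) ≤ n
    cp+Lpen+[clst+R]≤n = subst (_≤ n) (shuffle cp (c (lst q)) Lpen R) bound≤n
      where
      shuffle : ∀ x y z w → x + y + (z + w) ≡ x + z + (y + w)
      shuffle = solve-∀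

    cp+Lpen≤N₁ : cp + Lpen ≤ N₁
    cp+Lpen≤N₁ = m+n≤o⇒m≤o∸n (cp + Lpen) cp+Lpen+[clst+R]≤n

    opaque
      y : Fin (2 + q) → ℕ
      y = proj₁ (linearCombination-% cp (onSmall c) N₁ (subst (_∣ N₁) (sym gcd[cp,small-c]≡1) (1∣ N₁)))

      Σcy≡N₁ : sumF (λ k → onSmall c k * y k) % cp ≡ N₁ % cp
      Σcy≡N₁ = proj₂ (linearCombination-% cp (onSmall c) N₁ (subst (_∣ N₁) (sym gcd[cp,small-c]≡1) (1∣ N₁)))

    zₛ : Fin (2 + q) → ℕ
    zₛ k = residue₁ (y k) (T k)

    S₀ : ℕ
    S₀ = sumF (λ k → onSmall c k * zₛ k)

    S₀≡N₁ : S₀ % cp ≡ N₁ % cp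
    S₀≡N₁ = trans (sumF-%-cong cp _ _ term≡) Σcy≡N₁
      where
      term≡ : ∀ k → (onSmall c k * zₛ k) % cp ≡ (onSmall c k * y k) % cp
      term≡ k with toℕ k <? q
      ... | no _  = refl
      ... | yes _ = %-cong-*-∣ (zₛ k) (y k) (T k) (c k) cp (residue₁-% (y k) (T k)) (cp∣T*c k)
        where
        instance
          _ = >-nonZero (1≤A k (pen q))
          _ = >-nonZero (*-mono-≤ (1≤A k (pen q)) (1≤c k))

    S₀≤Lpen : S₀ ≤ Lpen
    S₀≤Lpen = sumF-mono-≤ term≤
      where
      term≤ : ∀ k → onSmall c k * zₛ k ≤ onSmall (λ k → L k (pen q)) k
      term≤ k with toℕ k <? q
      ... | no _  = z≤n
      ... | yes _ = subst (c k * zₛ k ≤_) (c*A≡L k (pen q)) (*-monoʳ-≤ (c k) (residue₁≤ (y k) (T k) (1≤A k (pen q))))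

    S₀≤N₁ : S₀ ≤ N₁
    S₀≤N₁ = ≤-trans S₀≤Lpen (≤-trans (m≤n+m Lpen cp) cp+Lpen≤N₁)

    zpen : ℕ
    zpen = (N₁ ∸ S₀) / cp

    zpen*cp≡ : zpen * cp ≡ N₁ ∸ S₀
    zpen*cp≡ = m/n*n≡m (%≡%⇒∣∸ N₁ S₀ cp (sym S₀≡N₁))

    1≤zpen : 1 ≤ zpen
    1≤zpen = m≥n⇒m/n>0 (m+n≤o⇒m≤o∸n cp (≤-trans (+-monoʳ-≤ cp S₀≤Lpen) cp+Lpen≤N₁))

    z : Fin (2 + q) → ℕ
    z k = if small k then zₛ k else (if ⌊ toℕ k ≟ q ⌋ then zpen else 1)

    z-pen : z (pen q) ≡ zpen
    z-pen = trans (if-⌊⌋-no (toℕ (pen q) <? q) (λ pen<q → <-irrefl toℕ-pen pen<q)) (if-⌊⌋-yes (toℕ (pen q) ≟ q) toℕ-pen)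

    z-lst : z (lst q) ≡ 1
    z-lst = trans (if-⌊⌋-no (toℕ (lst q) <? q) (λ lst<q → <-asym lst<q (subst (q <_) (sym toℕ-lst) (n<1+n q))))
                  (if-⌊⌋-no (toℕ (lst q) ≟ q) (λ lst≡q → <-irrefl (trans (sym lst≡q) toℕ-lst) (n<1+n q)))

    1≤z : ∀ k → 1 ≤ z k
    1≤z k with toℕ k <? q | toℕ k ≟ q
    ... | yes _ | _     = 1≤residue₁ (y k) (T k)
    ... | no _  | yes _ = 1≤zpen
    ... | no _  | no _  = s≤s z≤n

    Σcz≡ : sumF (λ k → c k * z k) + R ≡ n
    Σcz≡ = begin
      sumF (λ k → c k * z k) + R
        ≡⟨ cong (_+ R) (sumF-small+pen+lst (λ k → c k * z k)) ⟩
      sumF (onSmall (λ k → c k * z k)) + cp * z (pen q) + c (lst q) * z (lst q) + R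
        ≡⟨ cong₂ (λ u w → sumF (onSmall (λ k → c k * z k)) + u + w + R) (cong (cp *_) z-pen) (cong (c (lst q) *_) z-lst) ⟩
      sumF (onSmall (λ k → c k * z k)) + cp * zpen + c (lst q) * 1 + R
        ≡⟨ cong₂ (λ u w → u + cp * zpen + w + R) (sumF-cong onSmall-cz≡) (*-identityʳ _) ⟩
      S₀ + cp * zpen + c (lst q) + R
        ≡⟨ cong (λ u → S₀ + u + c (lst q) + R) (trans (*-comm cp zpen) zpen*cp≡) ⟩
      S₀ + (N₁ ∸ S₀) + c (lst q) + R
        ≡⟨ cong (λ u → u + c (lst q) + R) (m+[n∸m]≡n S₀≤N₁) ⟩
      N₁ + c (lst q) + R
        ≡⟨ +-assoc N₁ (c (lst q)) R ⟩
      N₁ + (c (lst q) + R)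
        ≡⟨ m∸n+n≡m (m+n≤o⇒n≤o (cp + Lpen) cp+Lpen+[clst+R]≤n) ⟩
      n ∎
      where
      open ≡-Reasoning
      onSmall-cz≡ : ∀ k → onSmall (λ k → c k * z k) k ≡ onSmall c k * zₛ k
      onSmall-cz≡ k with toℕ k <? q
      ... | yes _ = refl
      ... | no _  = refl

  baseSolution : ∀ n → cp + c (lst q) + (Lpen + R) ≤ n →
    ∃ λ (z : Fin (2 + q) → ℕ) → (∀ k → 1 ≤ z k) × z (lst q) ≡ 1 × sumF (λ k → c k * z k) + R ≡ n
  baseSolution n bound≤n = z , 1≤z , z-lst , Σcz≡
    where open BaseSolution n bound≤n

  -- For each inner pair i < j whose power pp i j divides both y i and y j, move L i j from
  -- index j to index i: y i gains A i j and y j loses B i j (c i * A i j = L i j = c j * B i j).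
  module Correction (z : Fin (2 + q) → ℕ) where

    y : Fin (2 + q) → ℕ
    y k = z k + slack k

    collide fix : Fin (2 + q) → Fin (2 + q) → Bool
    collide i j = ⌊ pp i j ∣? y i ⌋ ∧ ⌊ pp i j ∣? y j ⌋
    fix i j = innerPair i j ∧ collide i j

    gain loss : Fin (2 + q) → ℕ
    gain k = sumF (λ j → if fix k j then A k j else 0)
    loss k = sumF (λ i → if fix i k then B i k else 0)

    x : Fin (2 + q) → ℕ
    x k = (y k + gain k) ∸ loss k

    loss≤slack : ∀ k → loss k ≤ slack k
    loss≤slack k = sumF-mono-≤ (λ i → if-∧-0-≤ (innerPair i k) (collide i k) (B i k))

    x+loss≡y+gain : ∀ k → x k + loss k ≡ y k + gain k
    x+loss≡y+gain k = m∸n+n≡m (≤-trans (loss≤slack k) (≤-trans (m≤n+m (slack k) (z k)) (m≤m+n (y k) (gain k))))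

    z≤x : ∀ k → z k ≤ x k
    z≤x k = begin
      z k                    ≡⟨ m+n∸n≡m (z k) (slack k) ⟨
      y k ∸ slack k          ≤⟨ ∸-monoʳ-≤ (y k) (loss≤slack k) ⟩
      y k ∸ loss k           ≤⟨ ∸-monoˡ-≤ (loss k) (m≤m+n (y k) (gain k)) ⟩
      x k                    ∎
      where open ≤-Reasoning

    moved : Fin (2 + q) → Fin (2 + q) → ℕ
    moved i k = if fix i k then L i k else 0

    Σc*gain≡ : sumF (λ k → c k * gain k) ≡ sumF (λ k → sumF (λ i → moved i k))
    Σc*gain≡ =
      trans (sumF-cong (λ k → trans (sym (sumF-*ˡ (c k) (λ j → if fix k j then A k j else 0)))
                                    (sumF-cong (λ j → trans (*-if-0 (fix k j) (c k) (A k j))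
                                                            (cong (if fix k j then_else 0) (c*A≡L k j))))))
            (sumF-comm moved)

    Σc*loss≡ : sumF (λ k → c k * loss k) ≡ sumF (λ k → sumF (λ i → moved i k))
    Σc*loss≡ =
      sumF-cong (λ k → trans (sym (sumF-*ˡ (c k) (λ i → if fix i k then B i k else 0)))
                             (sumF-cong (λ i → trans (*-if-0 (fix i k) (c k) (B i k))
                                                     (cong (if fix i k then_else 0) (c*B≡L i k)))))

    Σc*x≡Σc*y : sumF (λ k → c k * x k) ≡ sumF (λ k → c k * y k)
    Σc*x≡Σc*y = +-cancelʳ-≡ Σmoved _ _ (begin
      sumF (λ k → c k * x k) + Σmoved                        ≡⟨ cong (sumF (λ k → c k * x k) +_) Σc*loss≡ ⟨
      sumF (λ k → c k * x k) + sumF (λ k → c k * loss k)     ≡⟨ sumF-+ (λ k → c k * x k) (λ k → c k * loss k) ⟨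
      sumF (λ k → c k * x k + c k * loss k)                  ≡⟨ sumF-cong (λ k → distrib k) ⟩
      sumF (λ k → c k * y k + c k * gain k)                  ≡⟨ sumF-+ (λ k → c k * y k) (λ k → c k * gain k) ⟩
      sumF (λ k → c k * y k) + sumF (λ k → c k * gain k)     ≡⟨ cong (sumF (λ k → c k * y k) +_) Σc*gain≡ ⟩
      sumF (λ k → c k * y k) + Σmoved                        ∎)
      where
      open ≡-Reasoning
      Σmoved = sumF (λ k → sumF (λ i → moved i k))
      distrib : ∀ k → c k * x k + c k * loss k ≡ c k * y k + c k * gain k
      distrib k = trans (sym (*-distribˡ-+ (c k) (x k) (loss k)))
                        (trans (cong (c k *_) (x+loss≡y+gain k)) (*-distribˡ-+ (c k) (y k) (gain k)))

    Σc*y≡ : sumF (λ k → c k * y k) ≡ sumF (λ k → c k * z k) + R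
    Σc*y≡ = trans (sumF-cong (λ k → *-distribˡ-+ (c k) (z k) (slack k)))
                  (sumF-+ (λ k → c k * z k) (λ k → c k * slack k))

    x-lst : x (lst q) ≡ z (lst q)
    x-lst = begin
      z (lst q) + slack (lst q) + gain (lst q) ∸ loss (lst q) ≡⟨ cong₃ (λ u v w → z (lst q) + u + v ∸ w) slack≡0 gain≡0 loss≡0 ⟩
      z (lst q) + 0 + 0 ∸ 0                                  ≡⟨ trans (+-identityʳ _) (+-identityʳ _) ⟩
      z (lst q)                                              ∎
      where
      open ≡-Reasoning
      cong₃ : ∀ (f : ℕ → ℕ → ℕ → ℕ) {u u′ v v′ w w′} → u ≡ u′ → v ≡ v′ → w ≡ w′ → f u v w ≡ f u′ v′ w′
      cong₃ f refl refl refl = refl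
      slack≡0 : slack (lst q) ≡ 0
      slack≡0 = trans (sumF-cong (λ i → cong (if_then B i (lst q) else 0) (innerPair-lst i))) (sumF-zero (2 + q))
      gain≡0 : gain (lst q) ≡ 0
      gain≡0 = trans (sumF-cong (λ j → cong (λ b → if (b ∧ ⌊ toℕ j ≤? q ⌋) ∧ collide (lst q) j then A (lst q) j else 0)
                                            (precedes-lst j)))
                     (sumF-zero (2 + q))
      loss≡0 : loss (lst q) ≡ 0
      loss≡0 = trans (sumF-cong (λ i → cong (λ b → if b ∧ collide i (lst q) then B i (lst q) else 0) (innerPair-lst i)))
                     (sumF-zero (2 + q))

    fix⇒< : ∀ i j → fix i j ≡ true → toℕ i < toℕ j
    fix⇒< i j fixed = innerPair⇒< i j (proj₁ (∧≡true⇒ {innerPair i j} fixed))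

    fix≡collide : ∀ {i j} X → innerPair i j ≡ true → (if fix i j then X else 0) ≡ (if collide i j then X else 0)
    fix≡collide {i} {j} X inner = cong (λ b → if b ∧ collide i j then X else 0) inner

    -- Every other correction touching i or j moves a multiple of pp i j, because the
    -- corresponding U contains the factor pp i j.
    module _ {i j} (inner : innerPair i j ≡ true) where

      private
        i<j = innerPair⇒< i j inner
        i≢j = Fin.<⇒≢ i<j
        d = pp i j

      d∣loss-i : d ∣ loss i
      d∣loss-i = ∣sumF (λ i′ → ∣-if-0 (fix i′ i) (B i′ i) (λ fixed → ∣n⇒∣m*n (α i′ i)
        (pp∣U i i′ i j i≢j (inj₁ refl) (λ where
          (inj₁ (_ , refl))  → <-asym i<j (fix⇒< i′ i fixed)
          (inj₂ (refl , _)) → <-irrefl refl (fix⇒< i′ i fixed)))))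

      d∣gain-j : d ∣ gain j
      d∣gain-j = ∣sumF (λ j′ → ∣-if-0 (fix j j′) (A j j′) (λ fixed → ∣n⇒∣m*n (β j j′)
        (pp∣U j j′ i j i≢j (inj₂ refl) (λ where
          (inj₁ (i≡j , _))  → i≢j i≡j
          (inj₂ (refl , _)) → <-asym i<j (fix⇒< j j′ fixed)))))

      x-i≈ : x i ≈ y i + (if collide i j then A i j else 0) mod d
      x-i≈ =
        let r , d∣r , gain≡ = sumF≡term+multiple (λ j′ → if fix i j′ then A i j′ else 0) j d∣other in
        loss i , r , d∣loss-i , d∣r , (begin
          x i + loss i                                        ≡⟨ x+loss≡y+gain i ⟩
          y i + gain i                                        ≡⟨ cong (y i +_) gain≡ ⟩
          y i + ((if fix i j then A i j else 0) + r)          ≡⟨ cong (λ t → y i + (t + r)) (fix≡collide (A i j) inner) ⟩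
          y i + ((if collide i j then A i j else 0) + r)      ≡⟨ +-assoc (y i) _ r ⟨
          y i + (if collide i j then A i j else 0) + r        ∎)
        where
        open ≡-Reasoning
        d∣other : ∀ j′ → j′ ≢ j → d ∣ (if fix i j′ then A i j′ else 0)
        d∣other j′ j′≢j = ∣-if-0 (fix i j′) (A i j′) (λ _ → ∣n⇒∣m*n (β i j′)
          (pp∣U i j′ i j i≢j (inj₁ refl) (λ where
            (inj₁ (_ , j≡j′)) → j′≢j (sym j≡j′)
            (inj₂ (_ , j≡i))  → i≢j (sym j≡i))))

      x-j≈ : x j + (if collide i j then B i j else 0) ≈ y j mod d
      x-j≈ =
        let r , d∣r , loss≡ = sumF≡term+multiple (λ i′ → if fix i′ j then B i′ j else 0) i d∣other in
        r , gain j , d∣r , d∣gain-j , (begin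
          x j + (if collide i j then B i j else 0) + r        ≡⟨ +-assoc (x j) _ r ⟩
          x j + ((if collide i j then B i j else 0) + r)      ≡⟨ cong (λ t → x j + (t + r)) (fix≡collide (B i j) inner) ⟨
          x j + ((if fix i j then B i j else 0) + r)          ≡⟨ cong (x j +_) loss≡ ⟨
          x j + loss j                                        ≡⟨ x+loss≡y+gain j ⟩
          y j + gain j                                        ∎)
        where
        open ≡-Reasoning
        d∣other : ∀ i′ → i′ ≢ i → d ∣ (if fix i′ j then B i′ j else 0)
        d∣other i′ i′≢i = ∣-if-0 (fix i′ j) (B i′ j) (λ _ → ∣n⇒∣m*n (α i′ j)
          (pp∣U j i′ i j i≢j (inj₂ refl) (λ where
            (inj₁ (i≡j , _))  → i≢j i≡j
            (inj₂ (i≡i′ , _)) → i′≢i (sym i≡i′))))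

      -- If pp i j divided both x i and x j: without a correction it would divide y i and y j, so
      -- a correction was made; with it, it would divide both A i j and B i j.
      pp∤x : d ∣ x i → ¬ (d ∣ x j)
      pp∤x d∣xi d∣xj = by-collide (collide i j) refl
        where
        by-collide : ∀ b → collide i j ≡ b → ⊥
        by-collide false col = false≢true (trans (sym col) (cong₂ _∧_ (⌊⌋-true (d ∣? y i) d∣yi) (⌊⌋-true (d ∣? y j) d∣yj)))
          where
          d∣yi : d ∣ y i
          d∣yi = subst (d ∣_) (trans (cong (λ b → y i + (if b then A i j else 0)) col) (+-identityʳ (y i))) (≈mod⇒∣ x-i≈ d∣xi)
          d∣yj : d ∣ y j
          d∣yj = ≈mod⇒∣ x-j≈ (subst (d ∣_) (trans (sym (+-identityʳ (x j))) (cong (λ b → x j + (if b then B i j else 0)) (sym col))) d∣xj)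
        by-collide true col = p∣A⇒p∤B i j i≢j (∣-trans (m∣m^n m 1≤m) d∣A) (∣-trans (m∣m^n m 1≤m) d∣B)
          where
          d∣yi : d ∣ y i
          d∣yi = ⌊⌋-true⇒ (d ∣? y i) (proj₁ (∧≡true⇒ col))
          d∣yj : d ∣ y j
          d∣yj = ⌊⌋-true⇒ (d ∣? y j) (proj₂ (∧≡true⇒ col))
          d∣A : d ∣ A i j
          d∣A = ∣m+n∣m⇒∣n (subst (λ b → d ∣ y i + (if b then A i j else 0)) col (≈mod⇒∣ x-i≈ d∣xi)) d∣yi
          d∣B : d ∣ B i j
          d∣B = ∣m+n∣m⇒∣n (subst (λ b → d ∣ x j + (if b then B i j else 0)) col (≈mod⇒∣ (≈mod-sym x-j≈) d∣yj)) d∣xj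

  representation : ∀ n → cp + c (lst q) + (Lpen + R) ≤ n →
    ∃ λ (x : Fin (2 + q) → ℕ) → (∀ k → 1 ≤ x k) × x (lst q) ≡ 1 ×
      (∀ i j → innerPair i j ≡ true → pp i j ∣ x i → ¬ (pp i j ∣ x j)) ×
      sumF (λ k → c k * x k) ≡ n
  representation n bound≤n =
    let z , 1≤z , z-lst , Σcz+R≡n = baseSolution n bound≤n
        open Correction z
    in x , (λ k → ≤-trans (1≤z k) (z≤x k)) , trans x-lst z-lst , (λ i j inner → pp∤x inner) ,
       trans Σc*x≡Σc*y (trans Σc*y≡ Σcz+R≡n)

  -- A prime r with r ^ m dividing every M k * x k divides M (lst q) (as x (lst q) = 1), so it is
  -- some p u w with u < w ≤ q; as p u w ∤ M u, M w, its m-th power divides both x u and x w.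
  M*x-powGcd≡1 : ∀ (x : Fin (2 + q) → ℕ) → x (lst q) ≡ 1 →
    (∀ i j → innerPair i j ≡ true → pp i j ∣ x i → ¬ (pp i j ∣ x j)) → PowGcdIsOne m (λ k → M k * x k)
  M*x-powGcd≡1 x x-lst≡1 pp∤x d d^m∣μ = ≢0⇒primeFree⇒≡1 d d≢0 primeFree
    where
    μ-lst≡ : M (lst q) * x (lst q) ≡ M (lst q)
    μ-lst≡ = trans (cong (M (lst q) *_) x-lst≡1) (*-identityʳ _)
    d≢0 : d ≢ 0
    d≢0 refl = <⇒≢ (1≤M (lst q)) (sym (0∣⇒≡0 (subst₂ _∣_ (0^m≡0 m 1≤m) μ-lst≡ (d^m∣μ (lst q)))))
      where
      0^m≡0 : ∀ m → 1 ≤ m → 0 ^ m ≡ 0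
      0^m≡0 (suc _) _ = refl
    primeFree : ∀ {r} → Prime r → ¬ (r ∣ d)
    primeFree {r} pr r∣d = from-pair (prime∣M (lst q) pr r∣M)
      where
      r^m∣μ : ∀ k → r ^ m ∣ M k * x k
      r^m∣μ k = ∣-trans (^-monoˡ-∣ m r∣d) (d^m∣μ k)
      r∣M : r ∣ M (lst q)
      r∣M = ∣-trans (m∣m^n m 1≤m) (subst (r ^ m ∣_) μ-lst≡ (r^m∣μ (lst q)))
      r^m∣x : ∀ u w → u ≢ w → r ≡ p u w → r ^ m ∣ x u
      r^m∣x u w u≢w r≡p = prime^∣*⇒∣ m pr (λ r∣M → p∤M u w u≢w (subst (_∣ M u) r≡p r∣M)) (r^m∣μ u)
      from-pair : (∃ λ u → ∃ λ w → toℕ u < toℕ w × u ≢ lst q × w ≢ lst q × r ≡ p u w) → ⊥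
      from-pair (u , w , u<w , _ , w≢lst , r≡p) =
        pp∤x u w uw-inner (subst (λ z → z ^ m ∣ x u) r≡p (r^m∣x u w u≢w r≡p))
                       (subst (λ z → z ^ m ∣ x w) r≡p (r^m∣x w u (λ w≡u → u≢w (sym w≡u)) r≡p′))
        where
        u≢w = Fin.<⇒≢ u<w
        r≡p′ = trans r≡p (p-sym u w)
        w≤q : toℕ w ≤ q
        w≤q = [ (λ w≤q → w≤q) , (λ w≡lst → ⊥-elim (w≢lst w≡lst)) ]′ (≤q⊎≡lst w)
        uw-inner : innerPair u w ≡ true
        uw-inner = cong₂ _∧_ (⌊⌋-true (toℕ u <? toℕ w) u<w) (⌊⌋-true (toℕ w ≤? q) w≤q)

  inS : ∀ n → bound m q a p ≤ n → ∀ t → t ≤ q → InS m (2 + q) t a n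
  inS n bound≤n t t≤q =
    let x , 1≤x , x-lst≡1 , pp∤x , Σcx≡n = representation n (subst (_≤ n) bound≡ bound≤n) in
    (λ k → M k * x k) , (λ k → *-mono-≤ (1≤M k) (1≤x k)) , M*x-powGcd≡1 x x-lst≡1 pp∤x ,
    (λ X ∣X∣≡t → M*-powGcd>1 x X (subst (λ u → 2 + u ≤ 2 + q) (sym ∣X∣≡t) (+-monoʳ-≤ 2 t≤q))) ,
    sym (trans (sumF-cong (λ k → sym (*-assoc (a k) (M k) (x k)))) Σcx≡n)

mainTheorem1 : (m q : ℕ) → 1 ≤ m → 1 ≤ q →
    (a : Fin (2 + q) → ℕ) → (∀ i → 1 ≤ a i) →
    gcdF (λ (i : Fin (2 + q)) → restrictTo (toℕ i) q (a i)) ≡ 1 →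
    (p : Fin (2 + q) → Fin (2 + q) → ℕ) →
    (∀ i j → p i j ≡ p j i) →
    (∀ i j → i ≢ j → Prime (p i j)) →
    (∀ i j k l → i ≢ j → k ≢ l → p i j ≡ p k l →
      (i ≡ k × j ≡ l) ⊎ (i ≡ l × j ≡ k)) →
    (∀ i j → i ≢ j → toℕ i ≤ q → toℕ j ≤ q → ¬ (p i j ∣ gcd (a i) (a j))) →
    (∀ i → toℕ i ≤ q → ¬ (p i (lst q) ∣ a i)) →
    ∀ n → 1 ≤ n → bound m q a p ≤ n →
      InS m (2 + q) q a n ×
      (∀ t → 1 ≤ t → t ≤ q → InS m (2 + q) t a n)
mainTheorem1 m q 1≤m _ a 1≤a gcd≡1 p p-sym p-prime p-injective p∤gcd p∤a n _ bound≤n =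
  inS n bound≤n q ≤-refl , λ t _ t≤q → inS n bound≤n t t≤q
  where open Setting m q 1≤m a 1≤a gcd≡1 p p-sym p-prime p-injective p∤gcd p∤a
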